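{- The map $\phi$ from the set of faces of $V_O$ to sets of oriented edges, $\phi(F)=\bigcup_{\lambda\in\mathcal U_F}\mathrm{supp}(\lambda)$ with $\mathcal U_F=\{\lambda\in\Xi_1:F\subseteq\mathrm H_\lambda\}$, is injective and order-preserving: if $F_1\subseteq F_2$ are faces of $V_O$, then $\phi(F_1)\preceq\phi(F_2)$.
   Context: Let $G=(V,E)$ be a finite connected graph, possibly with parallel edges and loops. $\mathbb E$ is the set of oriented edges (two opposite orientations per edge), $\bar e$ the reverse of $e$. A real (resp. integer) flow is $x:\mathbb E\to\mathbb R$ (resp. $\mathbb Z$) with $x_{\bar e}=-x_e$ and $\sum_{e:\,\mathrm{tail}(e)=v}x_e=0$ for all vertices $v$. $\mathrm H$ is the space of real flows, $\Lambda\subset \mathrm H$ the lattice of integer flows, $\langle x,y\rangle=\sum_{\text{edges}}x_ey_e$ (one orientation chosen per edge), $q(x)=\langle x,x\rangle$; $V_O=\{x\in\mathrm H:q(x)\le q(x-\mu)\ \forall\mu\in\Lambda\}$ is the Voronoi cell of the origin; faces are nonempty faces of this polytope. For a flow $x$, $\mathrm{supp}(x)=\{e\in\mathbb E:x_e>0\}$. $\Xi_1$ is the set of flows $x^C$ where $C$ is a circuit (orientation of a cycle of $G$ as a directed cycle) and $x^C_e=1$ if $e\in C$, $-1$ if $\bar e\in C$, $0$ otherwise. For $\lambda\in\Xi_1$, $\mathrm H_\lambda=\{x\in\mathrm H:2\langle x,\lambda\rangle=q(\lambda)\}$. For sets $D_1,D_2$ of oriented edges (orientations of subgraphs), $D_1\preceq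 D_2$ means $D_2\subseteq D_1$.
   Formalization: The space of flows $\mathrm H$ is taken over ℚ rather than ℝ, so the faces of $V_O$ are sets of rational flows maximising a linear functional with rational coefficients. -}

module Defs where

open import Data.Nat using (ℕ; zero; suc)
open import Data.Fin using (Fin; zero; suc; _≟_)
open import Data.Bool using (Bool; true; false; if_then_else_)
open import Data.Integer using (ℤ)
open import Data.Rational using (ℚ; 0ℚ; 1ℚ; _+_; _*_; -_; _-_; _≤_; _<_; _/_)
open import Data.Product using (Σ; ∃; _×_; _,_; proj₁)
open import Data.List using (List; []; _∷_; [_]; _++_; map)
open import Data.List.Relation.Unary.Unique.Propositional using (Unique)
open import Relation.Binary.PropositionalEquality using (_≡_)
open import Relation.Nullary using (does)

-- A finite graph with vertex set Fin n and edge set Fin m; each edge has a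
-- fixed reference orientation tail → head.  Loops (tail ≡ head) and parallel
-- edges are allowed.
record Graph : Set where
  field
    n    : ℕ
    m    : ℕ
    tail : Fin m → Fin n
    head : Fin m → Fin n

module _ (G : Graph) where
  open Graph G

  -- oriented edges: (e , true) = reference orientation, (e , false) = reverse ē
  OEdge : Set
  OEdge = Fin m × Bool

  otail : OEdge → Fin n
  otail (e , true)  = tail e
  otail (e , false) = head e

  ohead : OEdge → Fin n
  ohead (e , true)  = head e
  ohead (e , false) = tail e

  data Walk : Fin n → Fin n → Set where
    here : ∀ {v} → Walk v v
    step : ∀ {w} (o : OEdge) → Walk (ohead o) w → Walk (otail o) w

  Connected : Set
  Connected = ∀ u v → Walk u v

  -- a real-valued (here rational-valued) function on oriented edges with
  -- x_{ē} = - x_e is represented by its values on reference orientations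
  Vect : Set
  Vect = Fin m → ℚ

  val : Vect → OEdge → ℚ
  val x (e , true)  = x e
  val x (e , false) = - x e

  Σₑ : (Fin m → ℚ) → ℚ
  Σₑ = go
    where
    go : ∀ {k} → (Fin k → ℚ) → ℚ
    go {zero}  f = 0ℚ
    go {suc k} f = f zero + go (λ i → f (suc i))

  -- net outflow at v: Σ_{e : tail(e) = v} x_e over oriented edges
  outflow : Vect → Fin n → ℚ
  outflow x v = Σₑ (λ e →
    (if does (tail e ≟ v) then x e else 0ℚ) +
    (if does (head e ≟ v) then - x e else 0ℚ))

  IsFlow : Vect → Set
  IsFlow x = ∀ v → outflow x v ≡ 0ℚ

  IsIntFlow : Vect → Set
  IsIntFlow x = IsFlow x × ∃ λ (z : Fin m → ℤ) → ∀ e → x e ≡ z e / 1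

  ⟨_,_⟩ : Vect → Vect → ℚ
  ⟨ x , y ⟩ = Σₑ (λ e → x e * y e)

  q : Vect → ℚ
  q x = ⟨ x , x ⟩

  VO : Vect → Set
  VO x = IsFlow x × (∀ μ → IsIntFlow μ → q x ≤ q (λ e → x e - μ e))

  IsFace : (Vect → Set) → Set
  IsFace F = (∃ λ x → F x) ×
             ∃ λ (c : Vect) → ∀ x →
               (F x → VO x × (∀ y → VO y → ⟨ c , y ⟩ ≤ ⟨ c , x ⟩)) ×
               (VO x × (∀ y → VO y → ⟨ c , y ⟩ ≤ ⟨ c , x ⟩) → F x)

  Linked : List OEdge → Set
  Linked []            = Data.Unit.⊤ where import Data.Unit
  Linked (o ∷ [])      = Data.Unit.⊤ where import Data.Unit
  Linked (o ∷ p ∷ os)  = ohead o ≡ otail p × Linked (p ∷ os)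

  -- circuit: orientation of a cycle as a directed cycle, given as the
  -- cyclic list of its oriented edges (distinct vertices, distinct edges)
  IsCircuit : List OEdge → Set
  IsCircuit []       = Data.Empty.⊥ where import Data.Empty
  IsCircuit (o ∷ os) = Linked ((o ∷ os) ++ [ o ]) ×
                       Unique (map otail (o ∷ os)) ×
                       Unique (map proj₁ (o ∷ os))

  xC : List OEdge → Vect
  xC []             e = 0ℚ
  xC ((f , b) ∷ os) e =
    (if does (f ≟ e) then (if b then 1ℚ else - 1ℚ) else 0ℚ) + xC os e

  Ξ₁ : Vect → Set
  Ξ₁ λ' = ∃ λ C → IsCircuit C × (∀ e → λ' e ≡ xC C e)

  Hλ : Vect → Vect → Set
  Hλ λ' x = (1ℚ + 1ℚ) * ⟨ x , λ' ⟩ ≡ q λ'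

  supp : Vect → OEdge → Set
  supp x o = 0ℚ < val x o

  φ : (Vect → Set) → OEdge → Set
  φ F o = ∃ λ λ' → Ξ₁ λ' × (∀ x → F x → Hλ λ' x) × supp λ' o

{-# OPTIONS --safe #-}
-- Order reversal is immediate from the definition of φ; the content is that φ(F₂) ⊆ φ(F₁)
-- forces F₁ ⊆ F₂. Throughout, V_O is described by the circuit inequalities 2⟨x,λ⟩ ≤ q(λ), λ ∈ Ξ₁:
-- an integral flow μ splits conformally into circuits, which gives 2⟨x,μ⟩ ≤ ∥μ∥₁ ≤ q(μ).
-- Let x ∈ F₁. A circuit λ with supp(λ) ⊆ φ(F₁) is tight at x: choose for each edge of λ a circuit
-- tight on F₁ through that edge; their sum minus λ is an integral flow, and its inequality forces
-- 2⟨x,λ⟩ ≥ q(λ). Now take z in the relative interior of F₂. Every circuit hyperplane through z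
-- contains F₂, so its support lies in φ(F₂) ⊆ φ(F₁) and it passes through x. Hence z + ε(z - x)
-- lies in V_O for small ε > 0, so x maximises the functional defining F₂ as z does: x ∈ F₂.
module Submission where

open import Defs
open import Algebra.Bundles using (Ring)
open import Data.Bool using (Bool; true; false; if_then_else_)
open import Data.Empty using (⊥; ⊥-elim)
open import Data.Fin using (Fin; zero; suc) renaming (_≟_ to _≟ᶠ_; _<_ to _<ᶠ_)
import Data.Fin.Properties as Finₚ
open import Data.Fin.Properties using (pigeonhole)
open import Data.Integer as ℤ using (ℤ)
import Data.Integer.Properties as ℤₚ
open import Data.List using (List; []; _∷_; [_]; _++_; map; length; lookup)
open import Data.List.Membership.DecPropositional using () renaming (_∈?_ to member?)
open import Data.List.Membership.Propositional using (_∈_)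
open import Data.List.Membership.Propositional.Properties using (∈-lookup; ∈-map⁺; ∈-++⁺ˡ; ∈-++⁺ʳ)
open import Data.List.Relation.Unary.All as All using (All; []; _∷_)
open import Data.List.Relation.Unary.All.Properties using (map⁻; ¬Any⇒All¬)
open import Data.List.Relation.Unary.Any using (here; there)
open import Data.List.Relation.Unary.Unique.Propositional using (Unique; []; _∷_)
open import Data.Nat as ℕ using (ℕ; zero; suc; z≤n; s≤s)
import Data.Nat.Properties as ℕₚ
open import Data.Product using (∃; _×_; _,_; proj₁; proj₂)
open import Data.Rational hiding (truncate; pos)
open import Data.Rational.Properties
import Data.Rational.Unnormalised as ℚᵘ
import Data.Rational.Unnormalised.Properties as ℚᵘₚ
open import Data.Sum using (_⊎_; inj₁; inj₂)
import Data.Vec.Functional as Vector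
open import Effect.Monad using (RawMonad)
open import Function using (_∘_)
open import Function.Bundles using (_⇔_; mk⇔; Equivalence)
open import Level using (0ℓ)
open import Relation.Binary.Definitions using (tri<; tri≈; tri>)
open import Relation.Binary.PropositionalEquality hiding ([_])
open import Relation.Nullary using (does; yes; no; ¬_; Dec)
open import Relation.Nullary.Decidable using (_×-dec_; _⊎-dec_; ¬?; decidable-stable; ¬¬-excluded-middle; dec⇒maybe)
open import Relation.Nullary.Negation using (¬¬-Monad; ¬¬-map)
open import Tactic.RingSolver using (solve-∀)
import Tactic.RingSolver.Core.AlmostCommutativeRing as ACR

open import Algebra.Properties.Semiring.Sum (Ring.semiring +-*-ring)
  using (sum; ∑-distrib-+; ∑-comm; *-distribˡ-sum; *-distribʳ-sum; sum-cong-≗; sum-replicate-zero)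

ℚ-ring : ACR.AlmostCommutativeRing 0ℓ 0ℓ
ℚ-ring = ACR.fromCommutativeRing +-*-commutativeRing (λ p → dec⇒maybe (0ℚ ≟ p))

two : ℚ
two = 1ℚ + 1ℚ

0<1 : 0ℚ < 1ℚ
0<1 = positive⁻¹ 1ℚ

neg-involutive : ∀ p → - (- p) ≡ p
neg-involutive = solve-∀ ℚ-ring

0≤q-p⇒p≤q : ∀ {p q} → 0ℚ ≤ q - p → p ≤ q
0≤q-p⇒p≤q {p} {q} 0≤q-p = begin
  p             ≡⟨ sym (+-identityˡ p) ⟩
  0ℚ + p        ≤⟨ +-monoˡ-≤ p 0≤q-p ⟩
  (q - p) + p   ≡⟨ diff-cancel p q ⟩
  q             ∎
  where
  open ≤-Reasoning
  diff-cancel : ∀ p q → (q - p) + p ≡ q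
  diff-cancel = solve-∀ ℚ-ring

p≤q⇒0≤q-p : ∀ {p q} → p ≤ q → 0ℚ ≤ q - p
p≤q⇒0≤q-p {p} {q} p≤q = begin
  0ℚ      ≡⟨ sym (+-inverseʳ p) ⟩
  p - p   ≤⟨ +-monoˡ-≤ (- p) p≤q ⟩
  q - p   ∎
  where open ≤-Reasoning

p≤∣p∣ : ∀ p → p ≤ ∣ p ∣
p≤∣p∣ p with ≤-total p 0ℚ
... | inj₁ p≤0 = ≤-trans p≤0 (0≤∣p∣ p)
... | inj₂ 0≤p = ≤-reflexive (sym (0≤p⇒∣p∣≡p 0≤p))

a≤a-b+c⇒b≤c : ∀ {a b c} → a ≤ a - b + c → b ≤ c
a≤a-b+c⇒b≤c {a} {b} {c} h = 0≤q-p⇒p≤q (subst (0ℚ ≤_) (shift a b c) (p≤q⇒0≤q-p h))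
  where
  shift : ∀ a b c → a - b + c - a ≡ c - b
  shift = solve-∀ ℚ-ring

b≤c⇒a≤a-b+c : ∀ {a b c} → b ≤ c → a ≤ a - b + c
b≤c⇒a≤a-b+c {a} {b} {c} h = 0≤q-p⇒p≤q (subst (0ℚ ≤_) (shift a b c) (p≤q⇒0≤q-p h))
  where
  shift : ∀ a b c → c - b ≡ a - b + c - a
  shift = solve-∀ ℚ-ring

p<q⇒0<q-p : ∀ {p q} → p < q → 0ℚ < q - p
p<q⇒0<q-p {p} {q} p<q = subst (_< q - p) (+-inverseʳ p) (+-monoˡ-< (- p) p<q)

overshoot≤ : ∀ {z x q ε} → 0ℚ ≤ ε → z ≤ q → ε * ∣ q - x ∣ ≤ q - z → z + ε * (z - x) ≤ q
overshoot≤ {z} {x} {q} {ε} 0≤ε z≤q ε∣q-x∣≤q-z = begin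
  z + ε * (z - x)   ≤⟨ +-monoʳ-≤ z (≤-trans (*-monoˡ-≤-nonNeg ε {{nonNegative 0≤ε}} z-x≤∣q-x∣) ε∣q-x∣≤q-z) ⟩
  z + (q - z)       ≡⟨ cancel z q ⟩
  q                 ∎
  where
  open ≤-Reasoning
  z-x≤∣q-x∣ : z - x ≤ ∣ q - x ∣
  z-x≤∣q-x∣ = ≤-trans (+-monoˡ-≤ (- x) z≤q) (p≤∣p∣ (q - x))
  cancel : ∀ z q → z + (q - z) ≡ q
  cancel = solve-∀ ℚ-ring

p+ε[p-q]≤p⇒p≤q : ∀ {p q ε} → 0ℚ < ε → p + ε * (p - q) ≤ p → p ≤ q
p+ε[p-q]≤p⇒p≤q {p} {q} {ε} 0<ε overshoot = 0≤q-p⇒p≤q (*-cancelˡ-≤-pos ε {{positive 0<ε}}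
  (subst₂ _≤_ (sym (*-zeroʳ ε)) (rearrange p q ε) (p≤q⇒0≤q-p overshoot)))
  where
  rearrange : ∀ p q ε → p - (p + ε * (p - q)) ≡ ε * (q - p)
  rearrange = solve-∀ ℚ-ring

½[p+q]≤r : ∀ {p q r} → p ≤ r → q ≤ r → ½ * (p + q) ≤ r
½[p+q]≤r {p} {q} {r} p≤r q≤r = subst (½ * (p + q) ≤_) (halve r) (*-monoˡ-≤-nonNeg ½ (+-mono-≤ p≤r q≤r))
  where
  halve : ∀ r → ½ * (r + r) ≡ r
  halve = solve-∀ ℚ-ring

r≤½[p+q] : ∀ {p q r} → r ≤ p → r ≤ q → r ≤ ½ * (p + q)
r≤½[p+q] {p} {q} {r} r≤p r≤q = subst (_≤ ½ * (p + q)) (halve r) (*-monoˡ-≤-nonNeg ½ (+-mono-≤ r≤p r≤q))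
  where
  halve : ∀ r → ½ * (r + r) ≡ r
  halve = solve-∀ ℚ-ring

½[p+q]≡r⇒p≡r : ∀ {p q r} → p ≤ r → q ≤ r → ½ * (p + q) ≡ r → p ≡ r
½[p+q]≡r⇒p≡r {p} {q} {r} p≤r q≤r ½[p+q]≡r =
  ≤-antisym p≤r (0≤q-p⇒p≤q (subst (0ℚ ≤_) (subst (λ t → t - q ≡ p - t) ½[p+q]≡r (symmetric p q)) (p≤q⇒0≤q-p q≤r)))
  where
  symmetric : ∀ p q → ½ * (p + q) - q ≡ p - ½ * (p + q)
  symmetric = solve-∀ ℚ-ring

+-cancelʳ-≤ : ∀ r {p q} → p + r ≤ q + r → p ≤ q
+-cancelʳ-≤ r {p} {q} h = 0≤q-p⇒p≤q (subst (0ℚ ≤_) (cancel p q r) (p≤q⇒0≤q-p h))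
  where
  cancel : ∀ p q r → q + r - (p + r) ≡ q - p
  cancel = solve-∀ ℚ-ring

1≤p⇒∣p∣≡∣p-1∣+1 : ∀ {p} → 1ℚ ≤ p → ∣ p ∣ ≡ ∣ p - 1ℚ ∣ + 1ℚ
1≤p⇒∣p∣≡∣p-1∣+1 {p} 1≤p = begin
  ∣ p ∣              ≡⟨ 0≤p⇒∣p∣≡p (≤-trans (<⇒≤ 0<1) 1≤p) ⟩
  p                  ≡⟨ split p ⟩
  p - 1ℚ + 1ℚ        ≡⟨ cong (_+ 1ℚ) (sym (0≤p⇒∣p∣≡p (p≤q⇒0≤q-p 1≤p))) ⟩
  ∣ p - 1ℚ ∣ + 1ℚ    ∎
  where
  open ≡-Reasoning
  split : ∀ p → p ≡ p - 1ℚ + 1ℚ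
  split = solve-∀ ℚ-ring

-- Integer-valued rationals

fromℤ : ℤ → ℚ
fromℤ z = z / 1

IsInteger : ℚ → Set
IsInteger a = ∃ λ z → a ≡ fromℤ z

private
  toℚᵘ-fromℤ : ∀ z → toℚᵘ (fromℤ z) ℚᵘ.≃ ℚᵘ.mkℚᵘ z 0
  toℚᵘ-fromℤ z = toℚᵘ-fromℚᵘ (ℚᵘ.mkℚᵘ z 0)

fromℤ-+ : ∀ a b → fromℤ (a ℤ.+ b) ≡ fromℤ a + fromℤ b
fromℤ-+ a b = toℚᵘ-injective (begin
  toℚᵘ (fromℤ (a ℤ.+ b))                ≈⟨ toℚᵘ-fromℤ (a ℤ.+ b) ⟩
  ℚᵘ.mkℚᵘ (a ℤ.+ b) 0                   ≈⟨ ℚᵘ.*≡* (cong (ℤ._* ℤ.+ 1) (sym (cong₂ ℤ._+_ (ℤₚ.*-identityʳ a) (ℤₚ.*-identityʳ b)))) ⟩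
  ℚᵘ.mkℚᵘ a 0 ℚᵘ.+ ℚᵘ.mkℚᵘ b 0          ≈⟨ ℚᵘₚ.≃-sym (ℚᵘₚ.+-cong (toℚᵘ-fromℤ a) (toℚᵘ-fromℤ b)) ⟩
  toℚᵘ (fromℤ a) ℚᵘ.+ toℚᵘ (fromℤ b)    ≈⟨ ℚᵘₚ.≃-sym (toℚᵘ-homo-+ (fromℤ a) (fromℤ b)) ⟩
  toℚᵘ (fromℤ a + fromℤ b)              ∎)
  where open ℚᵘₚ.≃-Reasoning

fromℤ-neg : ∀ a → fromℤ (ℤ.- a) ≡ - fromℤ a
fromℤ-neg a = toℚᵘ-injective (ℚᵘₚ.≃-trans (toℚᵘ-fromℤ (ℤ.- a))
  (ℚᵘₚ.≃-sym (ℚᵘₚ.≃-trans (toℚᵘ-homo‿- (fromℤ a)) (ℚᵘₚ.-‿cong (toℚᵘ-fromℤ a)))))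

fromℤ-mono-≤ : ∀ {a b} → a ℤ.≤ b → fromℤ a ≤ fromℤ b
fromℤ-mono-≤ {a} {b} a≤b = toℚᵘ-cancel-≤
  (ℚᵘₚ.≤-respʳ-≃ (ℚᵘₚ.≃-sym (toℚᵘ-fromℤ b)) (ℚᵘₚ.≤-respˡ-≃ (ℚᵘₚ.≃-sym (toℚᵘ-fromℤ a))
    (ℚᵘ.*≤* (subst₂ ℤ._≤_ (sym (ℤₚ.*-identityʳ a)) (sym (ℤₚ.*-identityʳ b)) a≤b))))

IsInteger-0 : IsInteger 0ℚ
IsInteger-0 = ℤ.+ 0 , refl

IsInteger-1 : IsInteger 1ℚ
IsInteger-1 = ℤ.+ 1 , refl

IsInteger-+ : ∀ {a b} → IsInteger a → IsInteger b → IsInteger (a + b)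
IsInteger-+ (x , refl) (y , refl) = x ℤ.+ y , sym (fromℤ-+ x y)

IsInteger-neg : ∀ {a} → IsInteger a → IsInteger (- a)
IsInteger-neg (x , refl) = ℤ.- x , sym (fromℤ-neg x)

IsInteger-∣∣ : ∀ {a} → IsInteger a → IsInteger ∣ a ∣
IsInteger-∣∣ {a} a∈ℤ with ∣p∣≡p∨∣p∣≡-p a
... | inj₁ ∣a∣≡a  = subst IsInteger (sym ∣a∣≡a) a∈ℤ
... | inj₂ ∣a∣≡-a = subst IsInteger (sym ∣a∣≡-a) (IsInteger-neg a∈ℤ)

integer-trichotomy : ∀ {a} → IsInteger a → a ≡ 0ℚ ⊎ 1ℚ ≤ a ⊎ a ≤ - 1ℚ
integer-trichotomy (ℤ.+ zero     , refl) = inj₁ refl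
integer-trichotomy (ℤ.+[1+ n ]   , refl) = inj₂ (inj₁ (fromℤ-mono-≤ {ℤ.+ 1} {ℤ.+[1+ n ]} (ℤ.+≤+ (s≤s z≤n))))
integer-trichotomy (ℤ.-[1+ n ]   , refl) = inj₂ (inj₂ (fromℤ-mono-≤ {ℤ.-[1+ n ]} {ℤ.-[1+ 0 ]} (ℤ.-≤- z≤n)))

integer-pos⇒1≤ : ∀ {a} → IsInteger a → 0ℚ < a → 1ℚ ≤ a
integer-pos⇒1≤ a∈ℤ 0<a with integer-trichotomy a∈ℤ
... | inj₁ refl        = ⊥-elim (<-irrefl refl 0<a)
... | inj₂ (inj₁ 1≤a)  = 1≤a
... | inj₂ (inj₂ a≤-1) = ⊥-elim (<-asym 0<a (≤-<-trans a≤-1 (neg-antimono-< 0<1)))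

1≤p⇒p≤p*p : ∀ {p} → 1ℚ ≤ p → p ≤ p * p
1≤p⇒p≤p*p {p} 1≤p = subst (_≤ p * p) (*-identityʳ p)
  (*-monoˡ-≤-nonNeg p {{nonNegative (≤-trans (<⇒≤ 0<1) 1≤p)}} 1≤p)

1≤p⇒∣p∣≤p*p : ∀ {p} → 1ℚ ≤ p → ∣ p ∣ ≤ p * p
1≤p⇒∣p∣≤p*p {p} 1≤p = subst (_≤ p * p) (sym (0≤p⇒∣p∣≡p (≤-trans (<⇒≤ 0<1) 1≤p))) (1≤p⇒p≤p*p 1≤p)

integer-∣∣≤square : ∀ {a} → IsInteger a → ∣ a ∣ ≤ a * a
integer-∣∣≤square {a} a∈ℤ with integer-trichotomy a∈ℤ
... | inj₁ refl        = ≤-refl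
... | inj₂ (inj₁ 1≤a)  = 1≤p⇒∣p∣≤p*p 1≤a
... | inj₂ (inj₂ a≤-1) =
  subst₂ _≤_ (∣-p∣≡∣p∣ a) (neg*neg a) (1≤p⇒∣p∣≤p*p (neg-antimono-≤ a≤-1))
  where
  neg*neg : ∀ p → - p * - p ≡ p * p
  neg*neg = solve-∀ ℚ-ring

integer-bounded : ∀ {a} → IsInteger a → ∃ λ k → a ≤ fromℤ (ℤ.+ k)
integer-bounded (ℤ.+ k      , refl) = k , ≤-refl
integer-bounded (ℤ.-[1+ n ] , refl) = 0 , fromℤ-mono-≤ {ℤ.-[1+ n ]} {ℤ.+ 0} ℤ.-≤+

-- Finite sums and the coordinate space ℚ^k

private
  variable
    k : ℕ

ℚ^_ : ℕ → Set
ℚ^ k = Fin k → ℚ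

sum-0 : sum {k} (λ _ → 0ℚ) ≡ 0ℚ
sum-0 {k} = sum-replicate-zero k

sum-neg : (f : ℚ^ k) → sum (λ i → - f i) ≡ - sum f
sum-neg {zero}  f = refl
sum-neg {suc k} f = trans (cong (- f zero +_) (sum-neg (f ∘ suc))) (sym (neg-distrib-+ (f zero) _))

sum-mono-≤ : {f g : ℚ^ k} → (∀ i → f i ≤ g i) → sum f ≤ sum g
sum-mono-≤ {zero}  f≤g = ≤-refl
sum-mono-≤ {suc k} f≤g = +-mono-≤ (f≤g zero) (sum-mono-≤ (f≤g ∘ suc))

sum-mono-< : {f g : ℚ^ k} → (∀ i → f i ≤ g i) → ∀ j → f j < g j → sum f < sum g
sum-mono-< {suc k} f≤g zero    fj<gj = +-mono-<-≤ fj<gj (sum-mono-≤ (f≤g ∘ suc))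
sum-mono-< {suc k} f≤g (suc j) fj<gj = +-mono-≤-< (f≤g zero) (sum-mono-< (f≤g ∘ suc) j fj<gj)

∣sum∣≤sum∣∣ : (f : ℚ^ k) → ∣ sum f ∣ ≤ sum (λ i → ∣ f i ∣)
∣sum∣≤sum∣∣ {zero}  f = ≤-refl
∣sum∣≤sum∣∣ {suc k} f = ≤-trans (∣p+q∣≤∣p∣+∣q∣ (f zero) (sum (f ∘ suc)))
                                 (+-monoʳ-≤ ∣ f zero ∣ (∣sum∣≤sum∣∣ (f ∘ suc)))

sum-nonNeg : {f : ℚ^ k} → (∀ i → 0ℚ ≤ f i) → 0ℚ ≤ sum f
sum-nonNeg {k} {f} 0≤f = subst (_≤ sum f) (sum-0 {k}) (sum-mono-≤ 0≤f)

term≤sum : {f : ℚ^ k} → (∀ i → 0ℚ ≤ f i) → ∀ j → f j ≤ sum f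
term≤sum {suc k} {f} 0≤f zero = subst (_≤ sum f) (+-identityʳ (f zero))
  (+-monoʳ-≤ (f zero) (sum-nonNeg (0≤f ∘ suc)))
term≤sum {suc k} {f} 0≤f (suc j) = subst (_≤ sum f) (+-identityˡ (f (suc j)))
  (+-mono-≤ (0≤f zero) (term≤sum (0≤f ∘ suc) j))

sum-integer : {f : ℚ^ k} → (∀ i → IsInteger (f i)) → IsInteger (sum f)
sum-integer {zero}  f∈ℤ = IsInteger-0
sum-integer {suc k} f∈ℤ = IsInteger-+ (f∈ℤ zero) (sum-integer (f∈ℤ ∘ suc))

δ : Fin k → ℚ → ℚ^ k
δ j a i = if does (j ≟ᶠ i) then a else 0ℚ

sum-δ : ∀ (j : Fin k) a → sum (δ j a) ≡ a
sum-δ {suc k} zero    a = trans (cong (a +_) (sum-0 {k})) (+-identityʳ a)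
sum-δ {suc k} (suc j) a = trans (+-identityˡ _) (sum-δ j a)

infixl 6 _+ᵥ_ _-ᵥ_
infixl 7 _*ᵥ_ _·_

_+ᵥ_ _-ᵥ_ : ℚ^ k → ℚ^ k → ℚ^ k
(x +ᵥ y) i = x i + y i
(x -ᵥ y) i = x i - y i

-ᵥ_ : ℚ^ k → ℚ^ k
(-ᵥ x) i = - x i

_*ᵥ_ : ℚ → ℚ^ k → ℚ^ k
(a *ᵥ x) i = a * x i

0ᵥ : ℚ^ k
0ᵥ _ = 0ℚ

_·_ : ℚ^ k → ℚ^ k → ℚ
x · y = sum (λ i → x i * y i)

∥_∥₁ : ℚ^ k → ℚ
∥ x ∥₁ = sum (λ i → ∣ x i ∣)

·-cong : {x x′ y y′ : ℚ^ k} → x ≗ x′ → y ≗ y′ → x · y ≡ x′ · y′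
·-cong x≗x′ y≗y′ = sum-cong-≗ (λ i → cong₂ _*_ (x≗x′ i) (y≗y′ i))

·-comm : (x y : ℚ^ k) → x · y ≡ y · x
·-comm x y = sum-cong-≗ (λ i → *-comm (x i) (y i))

·-+ˡ : (x y z : ℚ^ k) → (x +ᵥ y) · z ≡ x · z + y · z
·-+ˡ x y z = trans (sum-cong-≗ (λ i → *-distribʳ-+ (z i) (x i) (y i))) (∑-distrib-+ (λ i → x i * z i) (λ i → y i * z i))

·-*ˡ : ∀ a (x z : ℚ^ k) → (a *ᵥ x) · z ≡ a * (x · z)
·-*ˡ a x z = trans (sum-cong-≗ (λ i → *-assoc a (x i) (z i))) (sym (*-distribˡ-sum a (λ i → x i * z i)))

·-negˡ : (x z : ℚ^ k) → (-ᵥ x) · z ≡ - (x · z)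
·-negˡ x z = trans (sum-cong-≗ (λ i → sym (neg-distribˡ-* (x i) (z i)))) (sum-neg (λ i → x i * z i))

·--ˡ : (x y z : ℚ^ k) → (x -ᵥ y) · z ≡ x · z - y · z
·--ˡ x y z = trans (·-+ˡ x (-ᵥ y) z) (cong (x · z +_) (·-negˡ y z))

·-+ʳ : (z x y : ℚ^ k) → z · (x +ᵥ y) ≡ z · x + z · y
·-+ʳ z x y = trans (·-comm z _) (trans (·-+ˡ x y z) (cong₂ _+_ (·-comm x z) (·-comm y z)))

·--ʳ : (z x y : ℚ^ k) → z · (x -ᵥ y) ≡ z · x - z · y
·--ʳ z x y = trans (·-comm z _) (trans (·--ˡ x y z) (cong₂ _-_ (·-comm x z) (·-comm y z)))

·-*ʳ : ∀ a (z x : ℚ^ k) → z · (a *ᵥ x) ≡ a * (z · x)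
·-*ʳ a z x = trans (·-comm z _) (trans (·-*ˡ a x z) (cong (a *_) (·-comm x z)))

·-0ʳ : (x : ℚ^ k) → x · 0ᵥ ≡ 0ℚ
·-0ʳ {k} x = trans (sum-cong-≗ (λ i → *-zeroʳ (x i))) (sum-0 {k})

·-δˡ : ∀ (j : Fin k) a y → δ j a · y ≡ a * y j
·-δˡ j a y = trans (sum-cong-≗ δ*y) (sum-δ j (a * y j))
  where
  δ*y : ∀ i → δ j a i * y i ≡ δ j (a * y j) i
  δ*y i with j ≟ᶠ i
  ... | yes refl = refl
  ... | no  _    = *-zeroˡ (y i)

·-sumˡ : ∀ {l} (D : Fin l → ℚ^ k) y → (λ i → sum (λ e → D e i)) · y ≡ sum (λ e → D e · y)
·-sumˡ D y = trans (sum-cong-≗ (λ i → *-distribʳ-sum (y i) (λ e → D e i))) (∑-comm (λ i e → D e i * y i))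

·-self-- : (x y : ℚ^ k) → (x -ᵥ y) · (x -ᵥ y) ≡ x · x - two * (x · y) + y · y
·-self-- x y = begin
  (x -ᵥ y) · (x -ᵥ y)                                            ≡⟨ sum-cong-≗ (λ i → square-- (x i) (y i)) ⟩
  sum (λ i → x i * x i + - (two * (x i * y i)) + y i * y i)      ≡⟨ ∑-distrib-+ (λ i → x i * x i + - (two * (x i * y i))) (λ i → y i * y i) ⟩
  sum (λ i → x i * x i + - (two * (x i * y i))) + y · y          ≡⟨ cong (_+ y · y) (∑-distrib-+ (λ i → x i * x i) (λ i → - (two * (x i * y i)))) ⟩
  x · x + sum (λ i → - (two * (x i * y i))) + y · y              ≡⟨ cong (λ t → x · x + t + y · y) (sum-neg (λ i → two * (x i * y i))) ⟩
  x · x - sum (λ i → two * (x i * y i)) + y · y                  ≡⟨ cong (λ t → x · x - t + y · y) (sym (*-distribˡ-sum two (λ i → x i * y i))) ⟩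
  x · x - two * (x · y) + y · y                                  ∎
  where
  open ≡-Reasoning
  square-- : ∀ a b → (a - b) * (a - b) ≡ a * a + - (two * (a * b)) + b * b
  square-- = solve-∀ ℚ-ring

∣sum-term∣+∣term∣≤sum∣∣ : ∀ {k} (g : ℚ^ k) j → ∣ sum g - g j ∣ + ∣ g j ∣ ≤ sum (λ i → ∣ g i ∣)
∣sum-term∣+∣term∣≤sum∣∣ {k} g j = begin
  ∣ sum g - g j ∣ + ∣ g j ∣                    ≡⟨ cong (λ t → ∣ t ∣ + ∣ g j ∣) (sym sum-h) ⟩
  ∣ sum h ∣ + ∣ g j ∣                          ≤⟨ +-monoˡ-≤ ∣ g j ∣ (∣sum∣≤sum∣∣ h) ⟩
  sum (λ i → ∣ h i ∣) + ∣ g j ∣                ≡⟨ cong (sum (λ i → ∣ h i ∣) +_) (sym (sum-δ j ∣ g j ∣)) ⟩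
  sum (λ i → ∣ h i ∣) + sum (δ j ∣ g j ∣)      ≡⟨ sym (∑-distrib-+ (λ i → ∣ h i ∣) (δ j ∣ g j ∣)) ⟩
  sum (λ i → ∣ h i ∣ + δ j ∣ g j ∣ i)          ≡⟨ sum-cong-≗ restore ⟩
  sum (λ i → ∣ g i ∣)                          ∎
  where
  open ≤-Reasoning
  h : ℚ^ k
  h = g -ᵥ δ j (g j)
  sum-h : sum h ≡ sum g - g j
  sum-h = trans (∑-distrib-+ g (-ᵥ δ j (g j))) (cong (sum g +_) (trans (sum-neg (δ j (g j))) (cong -_ (sum-δ j (g j)))))
  restore : ∀ i → ∣ h i ∣ + δ j ∣ g j ∣ i ≡ ∣ g i ∣
  restore i with j ≟ᶠ i
  ... | yes refl = trans (cong (λ t → ∣ t ∣ + ∣ g j ∣) (+-inverseʳ (g j))) (+-identityˡ ∣ g j ∣)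
  ... | no _     = trans (+-identityʳ _) (cong ∣_∣ (+-identityʳ (g i)))

-- Σₑ G sums by a local recursion on Fin (Graph.m G). Abstracting over m makes the unifier
-- solve the meta `edgeSum` with that recursion at every length, so it can be compared with sum.
private
  mutual
    edgeSum : Graph → (Fin k → ℚ) → ℚ
    edgeSum = _

    edgeSum≡Σₑ : ∀ G f → edgeSum G f ≡ Σₑ G f
    edgeSum≡Σₑ G with Graph.m G
    ... | _ = λ f → refl

  edgeSum≡sum : ∀ G (f : ℚ^ k) → edgeSum G f ≡ sum f
  edgeSum≡sum {zero}  G f = refl
  edgeSum≡sum {suc k} G f = cong (f zero +_) (edgeSum≡sum G (f ∘ suc))

Σₑ≡sum : ∀ G f → Σₑ G f ≡ sum f
Σₑ≡sum G f = trans (sym (edgeSum≡Σₑ G f)) (edgeSum≡sum G f)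

sgn : Bool → ℚ
sgn b = if b then 1ℚ else - 1ℚ

IsSign : ℚ → Set
IsSign a = a ≡ 0ℚ ⊎ a ≡ 1ℚ ⊎ a ≡ - 1ℚ

sgn-IsSign : ∀ b → IsSign (sgn b)
sgn-IsSign true  = inj₂ (inj₁ refl)
sgn-IsSign false = inj₂ (inj₂ refl)

IsSign⇒IsInteger : ∀ {a} → IsSign a → IsInteger a
IsSign⇒IsInteger (inj₁ refl)        = IsInteger-0
IsSign⇒IsInteger (inj₂ (inj₁ refl)) = IsInteger-1
IsSign⇒IsInteger (inj₂ (inj₂ refl)) = IsInteger-neg IsInteger-1

IsSign⇒square≡∣∣ : ∀ {a} → IsSign a → a * a ≡ ∣ a ∣
IsSign⇒square≡∣∣ (inj₁ refl)        = refl
IsSign⇒square≡∣∣ (inj₂ (inj₁ refl)) = refl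
IsSign⇒square≡∣∣ (inj₂ (inj₂ refl)) = refl

IsSign-pos : ∀ {a} → IsSign a → 0ℚ < a → a ≡ 1ℚ
IsSign-pos (inj₁ refl)        0<a = ⊥-elim (<-irrefl refl 0<a)
IsSign-pos (inj₂ (inj₁ a≡1))  0<a = a≡1
IsSign-pos (inj₂ (inj₂ refl)) 0<a = ⊥-elim (<-asym 0<a (neg-antimono-< 0<1))

IsSign-neg : ∀ {a} → IsSign a → 0ℚ < - a → a ≡ - 1ℚ
IsSign-neg (inj₁ refl)         0<-a = ⊥-elim (<-irrefl refl 0<-a)
IsSign-neg (inj₂ (inj₁ refl))  0<-a = ⊥-elim (<-asym 0<-a (neg-antimono-< 0<1))
IsSign-neg (inj₂ (inj₂ a≡-1))  0<-a = a≡-1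

∑ₗ : {A : Set} → (A → ℚ) → List A → ℚ
∑ₗ f []       = 0ℚ
∑ₗ f (a ∷ as) = f a + ∑ₗ f as

𝟙[_] : ∀ {k} → Fin k → Fin k → ℚ
𝟙[ v ] w = if does (w ≟ᶠ v) then 1ℚ else 0ℚ

if-neg : ∀ b → (if b then - 1ℚ else 0ℚ) ≡ - (if b then 1ℚ else 0ℚ)
if-neg true  = refl
if-neg false = refl

∑ₗ-cong : ∀ {A : Set} {f g : A → ℚ} → (∀ a → f a ≡ g a) → ∀ as → ∑ₗ f as ≡ ∑ₗ g as
∑ₗ-cong f≗g []       = refl
∑ₗ-cong f≗g (a ∷ as) = cong₂ _+_ (f≗g a) (∑ₗ-cong f≗g as)

unique-lookup-injective : ∀ {A : Set} {xs : List A} → Unique xs →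
                          ∀ {i j} → i <ᶠ j → lookup xs i ≢ lookup xs j
unique-lookup-injective (x∉xs ∷ _)  {zero}  {suc j} _           = All.lookup x∉xs (∈-lookup j)
unique-lookup-injective (_ ∷ unique) {suc i} {suc j} (s≤s i<j) = unique-lookup-injective unique i<j

unique-length : ∀ {k} {xs : List (Fin k)} → Unique xs → length xs ℕ.≤ k
unique-length {k} {xs} unique = ℕₚ.≮⇒≥ λ k<len →
  let i , j , i<j , xs[i]≡xs[j] = pigeonhole k<len (lookup xs)
  in unique-lookup-injective unique i<j xs[i]≡xs[j]

prependAll : ℚ → List (ℚ^ k) → List (ℚ^ suc k)
prependAll a = map (a Vector.∷_)

signVectors : ∀ k → List (ℚ^ k)
signVectors zero    = [ (λ ()) ]
signVectors (suc k) = prependAll 0ℚ vs ++ prependAll 1ℚ vs ++ prependAll (- 1ℚ) vs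
  where vs = signVectors k

signVectors-complete : (g : ℚ^ k) → (∀ i → IsSign (g i)) → ∃ λ s → s ∈ signVectors k × s ≗ g
signVectors-complete {zero}  g _  = (λ ()) , here refl , λ ()
signVectors-complete {suc k} g g± with signVectors-complete (g ∘ suc) (g± ∘ suc)
... | s , s∈ , s≗g = g zero Vector.∷ s , extended (g± zero) , λ { zero → refl ; (suc i) → s≗g i }
  where
  extended : ∀ {a} → IsSign a → (a Vector.∷ s) ∈ signVectors (suc k)
  extended (inj₁ refl)        = ∈-++⁺ˡ (∈-map⁺ (0ℚ Vector.∷_) s∈)
  extended (inj₂ (inj₁ refl)) = ∈-++⁺ʳ (prependAll 0ℚ vs) (∈-++⁺ˡ (∈-map⁺ (1ℚ Vector.∷_) s∈))
    where vs = signVectors k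
  extended (inj₂ (inj₂ refl)) = ∈-++⁺ʳ (prependAll 0ℚ vs) (∈-++⁺ʳ (prependAll 1ℚ vs) (∈-map⁺ (- 1ℚ Vector.∷_) s∈))
    where vs = signVectors k

scale-below : ∀ {s} b → 0ℚ < s → ∃ λ d → 0ℚ < d × d * ∣ b ∣ ≤ s
scale-below {s} b 0<s = d , 0<d , (begin
  d * ∣ b ∣   ≤⟨ *-monoˡ-≤-nonNeg d {{nonNegative (<⇒≤ 0<d)}} ∣b∣≤w ⟩
  d * w       ≡⟨ *-assoc s (1/ w) w ⟩
  s * (1/ w * w) ≡⟨ cong (s *_) (*-inverseˡ w) ⟩
  s * 1ℚ      ≡⟨ *-identityʳ s ⟩
  s           ∎)
  where
  open ≤-Reasoning
  w = 1ℚ + ∣ b ∣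
  0<w : 0ℚ < w
  0<w = <-≤-trans 0<1 (subst (_≤ w) (+-identityʳ 1ℚ) (+-monoʳ-≤ 1ℚ (0≤∣p∣ b)))
  instance
    w-pos : Positive w
    w-pos = positive 0<w
    w≢0 : NonZero w
    w≢0 = pos⇒nonZero w
  d = s * 1/ w
  0<d : 0ℚ < d
  0<d = positive⁻¹ d {{pos*pos⇒pos s {{positive 0<s}} (1/ w) {{1/pos⇒pos w}}}}
  ∣b∣≤w : ∣ b ∣ ≤ w
  ∣b∣≤w = subst (_≤ w) (+-identityˡ ∣ b ∣) (+-monoˡ-≤ ∣ b ∣ (<⇒≤ 0<1))

uniformly-scale-below : ∀ {A : Set} (L : List A) (slack size : A → ℚ) →
  ∃ λ ε → 0ℚ < ε × (∀ {a} → a ∈ L → 0ℚ < slack a → ε * ∣ size a ∣ ≤ slack a)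
uniformly-scale-below []      slack size = 1ℚ , 0<1 , λ ()
uniformly-scale-below (a ∷ L) slack size with uniformly-scale-below L slack size | 0ℚ <? slack a
... | ε , 0<ε , ε-ok | no ¬0<slack = ε , 0<ε , λ
  { (here refl) 0<slack → ⊥-elim (¬0<slack 0<slack)
  ; (there a∈L) → ε-ok a∈L }
... | ε , 0<ε , ε-ok | yes 0<slack with scale-below (size a) 0<slack
... | d , 0<d , d-ok = ε ⊓ d , 0<ε⊓d , λ
  { (here refl) _       → ≤-trans (shrink (p⊓q≤q ε d)) d-ok
  ; (there a∈L) 0<slack → ≤-trans (shrink (p⊓q≤p ε d)) (ε-ok a∈L 0<slack) }
  where
  0<ε⊓d : 0ℚ < ε ⊓ d
  0<ε⊓d with ⊓-sel ε d
  ... | inj₁ ε⊓d≡ε = subst (0ℚ <_) (sym ε⊓d≡ε) 0<ε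
  ... | inj₂ ε⊓d≡d = subst (0ℚ <_) (sym ε⊓d≡d) 0<d
  shrink : ∀ {r b} → ε ⊓ d ≤ r → (ε ⊓ d) * ∣ b ∣ ≤ r * ∣ b ∣
  shrink {b = b} ≤r = *-monoʳ-≤-nonNeg ∣ b ∣ {{nonNegative (0≤∣p∣ b)}} ≤r

module _ (G : Graph) where
  open Graph G

  inner≡· : ∀ x y → ⟨_,_⟩ G x y ≡ x · y
  inner≡· x y = Σₑ≡sum G (λ e → x e * y e)

  q≡· : ∀ x → q G x ≡ x · x
  q≡· x = inner≡· x x

  incidence : Fin n → Vect G
  incidence v e = 𝟙[ v ] (tail e) + (if does (head e ≟ᶠ v) then - 1ℚ else 0ℚ)

  outflow≡·incidence : ∀ x v → outflow G x v ≡ x · incidence v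
  outflow≡·incidence x v =
    trans (Σₑ≡sum G _) (sum-cong-≗ (λ e → linear (does (tail e ≟ᶠ v)) (does (head e ≟ᶠ v)) (x e)))
    where
    linear : ∀ s t a → (if s then a else 0ℚ) + (if t then - a else 0ℚ)
                     ≡ a * ((if s then 1ℚ else 0ℚ) + (if t then - 1ℚ else 0ℚ))
    linear s t a = trans (cong₂ _+_ (scale s) (scale-neg t)) (sym (*-distribˡ-+ a _ _))
      where
      scale : ∀ s → (if s then a else 0ℚ) ≡ a * (if s then 1ℚ else 0ℚ)
      scale true  = sym (*-identityʳ a)
      scale false = sym (*-zeroʳ a)
      scale-neg : ∀ t → (if t then - a else 0ℚ) ≡ a * (if t then - 1ℚ else 0ℚ)
      scale-neg true  = neg≡*-1 a
        where
        neg≡*-1 : ∀ a → - a ≡ a * - 1ℚ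
        neg≡*-1 = solve-∀ ℚ-ring
      scale-neg false = sym (*-zeroʳ a)

  flow⇒·incidence : ∀ {x} → IsFlow G x → ∀ v → x · incidence v ≡ 0ℚ
  flow⇒·incidence {x} fx v = trans (sym (outflow≡·incidence x v)) (fx v)

  ·incidence⇒flow : ∀ {x} → (∀ v → x · incidence v ≡ 0ℚ) → IsFlow G x
  ·incidence⇒flow {x} x⊥ v = trans (outflow≡·incidence x v) (x⊥ v)

  IsFlow-resp : ∀ {x y} → x ≗ y → IsFlow G x → IsFlow G y
  IsFlow-resp {x} {y} x≗y fx = ·incidence⇒flow λ v →
    trans (·-cong (sym ∘ x≗y) (λ _ → refl)) (flow⇒·incidence fx v)

  IsFlow-+ : ∀ {x y} → IsFlow G x → IsFlow G y → IsFlow G (x +ᵥ y)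
  IsFlow-+ {x} {y} fx fy = ·incidence⇒flow λ v →
    trans (·-+ˡ x y (incidence v)) (cong₂ _+_ (flow⇒·incidence fx v) (flow⇒·incidence fy v))

  IsFlow-- : ∀ {x y} → IsFlow G x → IsFlow G y → IsFlow G (x -ᵥ y)
  IsFlow-- {x} {y} fx fy = ·incidence⇒flow λ v →
    trans (·--ˡ x y (incidence v)) (cong₂ _-_ (flow⇒·incidence fx v) (flow⇒·incidence fy v))

  IsFlow-* : ∀ a {x} → IsFlow G x → IsFlow G (a *ᵥ x)
  IsFlow-* a {x} fx = ·incidence⇒flow λ v →
    trans (·-*ˡ a x (incidence v)) (trans (cong (a *_) (flow⇒·incidence fx v)) (*-zeroʳ a))

  IsFlow-0 : IsFlow G 0ᵥ
  IsFlow-0 = ·incidence⇒flow λ v → trans (·-comm 0ᵥ (incidence v)) (·-0ʳ (incidence v))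

  IsFlow-sum : ∀ {l} {D : Fin l → Vect G} → (∀ i → IsFlow G (D i)) → IsFlow G (λ e → sum (λ i → D i e))
  IsFlow-sum {l} {D} fD = ·incidence⇒flow λ v →
    trans (·-sumˡ D (incidence v)) (trans (sum-cong-≗ (λ i → flow⇒·incidence (fD i) v)) (sum-0 {l}))

  -- Circuit vectors

  val-sgn : ∀ y f b → sgn b * y f ≡ val G y (f , b)
  val-sgn y f true  = *-identityˡ (y f)
  val-sgn y f false = trans (sym (neg-distribˡ-* 1ℚ (y f))) (cong -_ (*-identityˡ (y f)))

  xC-· : ∀ L y → xC G L · y ≡ ∑ₗ (val G y) L
  xC-· []             y = trans (·-comm 0ᵥ y) (·-0ʳ y)
  xC-· ((f , b) ∷ os) y = begin
    (δ f (sgn b) +ᵥ xC G os) · y        ≡⟨ ·-+ˡ (δ f (sgn b)) (xC G os) y ⟩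
    δ f (sgn b) · y + xC G os · y       ≡⟨ cong₂ _+_ (·-δˡ f (sgn b) y) (xC-· os y) ⟩
    sgn b * y f + ∑ₗ (val G y) os       ≡⟨ cong (_+ ∑ₗ (val G y) os) (val-sgn y f b) ⟩
    ∑ₗ (val G y) ((f , b) ∷ os)         ∎
    where open ≡-Reasoning

  telescope : ∀ (g : Fin n → ℚ) o os p → Linked G (o ∷ os ++ [ p ]) →
              ∑ₗ (λ r → g (otail G r) - g (ohead G r)) (o ∷ os) ≡ g (otail G o) - g (otail G p)
  telescope g o []        p (o→p , _) =
    trans (+-identityʳ _) (cong (λ w → g (otail G o) - g w) o→p)
  telescope g o (o′ ∷ os) p (o→o′ , linked) = begin
    g (otail G o) - g (ohead G o) + ∑ₗ (λ r → g (otail G r) - g (ohead G r)) (o′ ∷ os)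
      ≡⟨ cong₂ (λ w s → g (otail G o) - g w + s) o→o′ (telescope g o′ os p linked) ⟩
    g (otail G o) - g (otail G o′) + (g (otail G o′) - g (otail G p))
      ≡⟨ cancel (g (otail G o)) (g (otail G o′)) (g (otail G p)) ⟩
    g (otail G o) - g (otail G p)
      ∎
    where
    open ≡-Reasoning
    cancel : ∀ a b c → a - b + (b - c) ≡ a - c
    cancel = solve-∀ ℚ-ring

  val-incidence : ∀ v o → val G (incidence v) o ≡ 𝟙[ v ] (otail G o) - 𝟙[ v ] (ohead G o)
  val-incidence v (e , true)  = cong (𝟙[ v ] (tail e) +_) (if-neg (does (head e ≟ᶠ v)))
  val-incidence v (e , false) = trans (cong (λ t → - (𝟙[ v ] (tail e) + t)) (if-neg (does (head e ≟ᶠ v))))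
                                      (flip (𝟙[ v ] (tail e)) (𝟙[ v ] (head e)))
    where
    flip : ∀ a b → - (a + - b) ≡ b - a
    flip = solve-∀ ℚ-ring

  IsCircuit⇒IsFlow : ∀ {C} → IsCircuit G C → IsFlow G (xC G C)
  IsCircuit⇒IsFlow {o ∷ os} (closed , _) = ·incidence⇒flow λ v → begin
    xC G (o ∷ os) · incidence v                                   ≡⟨ xC-· (o ∷ os) (incidence v) ⟩
    ∑ₗ (val G (incidence v)) (o ∷ os)                             ≡⟨ ∑ₗ-cong (val-incidence v) (o ∷ os) ⟩
    ∑ₗ (λ r → 𝟙[ v ] (otail G r) - 𝟙[ v ] (ohead G r)) (o ∷ os)  ≡⟨ telescope 𝟙[ v ] o os o closed ⟩
    𝟙[ v ] (otail G o) - 𝟙[ v ] (otail G o)                       ≡⟨ +-inverseʳ (𝟙[ v ] (otail G o)) ⟩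
    0ℚ                                                            ∎
    where open ≡-Reasoning

  xC-entry : ∀ L → Unique (map proj₁ L) → ∀ e →
             (All (λ o → proj₁ o ≢ e) L × xC G L e ≡ 0ℚ) ⊎ (∃ λ b → (e , b) ∈ L × xC G L e ≡ sgn b)
  xC-entry []            _          e = inj₁ ([] , refl)
  xC-entry ((f , b) ∷ L) (f∉L ∷ u) e with f ≟ᶠ e | xC-entry L u e
  ... | yes refl | inj₁ (_ , xL≡0)         = inj₂ (b , here refl , trans (cong (sgn b +_) xL≡0) (+-identityʳ _))
  ... | yes refl | inj₂ (b′ , fb′∈L , _)   = ⊥-elim (All.lookup (map⁻ f∉L) fb′∈L refl)
  ... | no f≢e   | inj₁ (off , xL≡0)       = inj₁ (f≢e ∷ off , trans (+-identityˡ _) xL≡0)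
  ... | no _     | inj₂ (b′ , eb′∈L , xL≡) = inj₂ (b′ , there eb′∈L , trans (+-identityˡ _) xL≡)

  xC-IsSign : ∀ {C} → IsCircuit G C → ∀ e → IsSign (xC G C e)
  xC-IsSign {C@(_ ∷ _)} (_ , _ , distinct) e with xC-entry C distinct e
  ... | inj₁ (_ , x≡0)      = inj₁ x≡0
  ... | inj₂ (b , _ , x≡±1) = subst IsSign (sym x≡±1) (sgn-IsSign b)

  Ξ₁-resp : ∀ {λ₁ λ₂} → λ₁ ≗ λ₂ → Ξ₁ G λ₁ → Ξ₁ G λ₂
  Ξ₁-resp λ₁≗λ₂ (C , circuit , λ₁≗xC) = C , circuit , λ e → trans (sym (λ₁≗λ₂ e)) (λ₁≗xC e)

  Ξ₁-IsFlow : ∀ {λ′} → Ξ₁ G λ′ → IsFlow G λ′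
  Ξ₁-IsFlow (_ , circuit , λ≗xC) = IsFlow-resp (sym ∘ λ≗xC) (IsCircuit⇒IsFlow circuit)

  Ξ₁-IsSign : ∀ {λ′} → Ξ₁ G λ′ → ∀ e → IsSign (λ′ e)
  Ξ₁-IsSign (_ , circuit , λ≗xC) e = subst IsSign (sym (λ≗xC e)) (xC-IsSign circuit e)

  IsIntegral : Vect G → Set
  IsIntegral x = ∀ e → IsInteger (x e)

  IsIntFlow⇒IsIntegral : ∀ {μ} → IsIntFlow G μ → IsIntegral μ
  IsIntFlow⇒IsIntegral (_ , z , μ≡z) e = z e , μ≡z e

  IsIntegral⇒IsIntFlow : ∀ {μ} → IsFlow G μ → IsIntegral μ → IsIntFlow G μ
  IsIntegral⇒IsIntFlow fμ iμ = fμ , proj₁ ∘ iμ , proj₂ ∘ iμ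

  Ξ₁-IsIntFlow : ∀ {λ′} → Ξ₁ G λ′ → IsIntFlow G λ′
  Ξ₁-IsIntFlow ξ = IsIntegral⇒IsIntFlow (Ξ₁-IsFlow ξ) (IsSign⇒IsInteger ∘ Ξ₁-IsSign ξ)

  sign-vector-·-self : ∀ {x : Vect G} → (∀ e → IsSign (x e)) → x · x ≡ ∥ x ∥₁
  sign-vector-·-self x± = sum-cong-≗ (IsSign⇒square≡∣∣ ∘ x±)

  Ξ₁-·-self : ∀ {λ′} → Ξ₁ G λ′ → λ′ · λ′ ≡ ∥ λ′ ∥₁
  Ξ₁-·-self ξ = sign-vector-·-self (Ξ₁-IsSign ξ)

  -- Hλ G λ′ x says that x lies on the hyperplane bisecting 0 and λ′; Below x λ′ says x lies
  -- in the closed half-space on the side of 0.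

  Below : Vect G → Vect G → Set
  Below x μ = two * (x · μ) ≤ μ · μ

  Hλ⇒≡ : ∀ {λ′ x} → Hλ G λ′ x → two * (x · λ′) ≡ λ′ · λ′
  Hλ⇒≡ {λ′} {x} h = trans (cong (two *_) (sym (inner≡· x λ′))) (trans h (q≡· λ′))

  ≡⇒Hλ : ∀ {λ′ x} → two * (x · λ′) ≡ λ′ · λ′ → Hλ G λ′ x
  ≡⇒Hλ {λ′} {x} h = trans (cong (two *_) (inner≡· x λ′)) (trans h (sym (q≡· λ′)))

  Hλ-resp : ∀ {λ₁ λ₂ x} → λ₁ ≗ λ₂ → Hλ G λ₁ x → Hλ G λ₂ x
  Hλ-resp {λ₁} {λ₂} {x} λ₁≗λ₂ h =
    ≡⇒Hλ {λ₂} {x} (trans (cong (two *_) (·-cong {x = x} {x′ = x} (λ _ → refl) (sym ∘ λ₁≗λ₂)))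
                   (trans (Hλ⇒≡ {λ₁} {x} h) (·-cong λ₁≗λ₂ λ₁≗λ₂)))

  VO⇒Below : ∀ {x μ} → VO G x → IsIntFlow G μ → Below x μ
  VO⇒Below {x} {μ} (_ , nearest) μ∈Λ =
    a≤a-b+c⇒b≤c (subst₂ _≤_ (q≡· x) (trans (q≡· (x -ᵥ μ)) (·-self-- x μ)) (nearest μ μ∈Λ))

  Below⇒VO : ∀ {x} → IsFlow G x → (∀ μ → IsIntFlow G μ → Below x μ) → VO G x
  Below⇒VO {x} fx below = fx , λ μ μ∈Λ →
    subst₂ _≤_ (sym (q≡· x)) (sym (trans (q≡· (x -ᵥ μ)) (·-self-- x μ))) (b≤c⇒a≤a-b+c (below μ μ∈Λ))

  CircuitBelow : Vect G → Set
  CircuitBelow x = ∀ λ′ → Ξ₁ G λ′ → Below x λ′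

  VO⇒CircuitBelow : ∀ {x} → VO G x → CircuitBelow x
  VO⇒CircuitBelow x∈VO λ′ ξ = VO⇒Below x∈VO (Ξ₁-IsIntFlow ξ)

  -- Positive circuits of a flow

  Pos : Vect G → OEdge G → Set
  Pos v o = 0ℚ < val G v o

  positive-in-edge : ∀ {v} → IsFlow G v → ∀ o → Pos v o → ∃ λ o′ → ohead G o′ ≡ otail G o × Pos v o′
  positive-in-edge {v} fv o pos-o with Finₚ.any? (λ e → enters? (e , true) ⊎-dec enters? (e , false))
    where
    enters? : ∀ o′ → Dec (ohead G o′ ≡ otail G o × Pos v o′)
    enters? o′ = (ohead G o′ ≟ᶠ otail G o) ×-dec (0ℚ <? val G v o′)
  ... | yes (e , inj₁ e→u) = (e , true)  , e→u
  ... | yes (e , inj₂ e→u) = (e , false) , e→u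
  ... | no none = ⊥-elim (<-irrefl (sym (fv u)) (begin-strict
    0ℚ                 ≡⟨ sym (sum-0 {m}) ⟩
    sum (λ (_ : Fin m) → 0ℚ) <⟨ sum-mono-< summand-nonNeg (proj₁ o) (summand-pos o refl pos-o) ⟩
    sum summand        ≡⟨ sym (Σₑ≡sum G summand) ⟩
    outflow G v u      ∎))
    where
    open ≤-Reasoning
    u = otail G o
    summand : Fin m → ℚ
    summand e = (if does (tail e ≟ᶠ u) then v e else 0ℚ) + (if does (head e ≟ᶠ u) then - v e else 0ℚ)
    summand-nonNeg : ∀ e → 0ℚ ≤ summand e
    summand-nonNeg e with tail e ≟ᶠ u | head e ≟ᶠ u
    ... | yes _   | yes _   = ≤-reflexive (sym (+-inverseʳ (v e)))
    ... | yes t≡u | no _    = subst (0ℚ ≤_) (sym (+-identityʳ (v e)))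
                                (≮⇒≥ λ ve<0 → none (e , inj₂ (t≡u , neg-antimono-< ve<0)))
    ... | no _    | yes h≡u = subst (0ℚ ≤_) (sym (+-identityˡ (- v e)))
                                (≮⇒≥ λ -ve<0 → none (e , inj₁ (h≡u , <-respʳ-≡ (neg-involutive (v e)) (neg-antimono-< -ve<0))))
    ... | no _    | no _    = ≤-refl
    summand-pos : ∀ o′ → otail G o′ ≡ u → Pos v o′ → 0ℚ < summand (proj₁ o′)
    summand-pos (e , true) t≡u pos with tail e ≟ᶠ u | head e ≟ᶠ u
    ... | no t≢u | _       = ⊥-elim (t≢u t≡u)
    ... | yes _  | yes h≡u = ⊥-elim (none (e , inj₁ (h≡u , pos)))
    ... | yes _  | no _    = subst (0ℚ <_) (sym (+-identityʳ (v e))) pos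
    summand-pos (e , false) h≡u pos with tail e ≟ᶠ u | head e ≟ᶠ u
    ... | _       | no h≢u = ⊥-elim (h≢u h≡u)
    ... | yes t≡u | yes _  = ⊥-elim (none (e , inj₂ (t≡u , pos)))
    ... | no _    | yes _  = subst (0ℚ <_) (sym (+-identityˡ (- v e))) pos

  Path : Fin n → List (OEdge G) → Fin n → Set
  Path s []      t = s ≡ t
  Path s (o ∷ P) t = otail G o ≡ s × Path (ohead G o) P t

  vertices : List (OEdge G) → Fin n → List (Fin n)
  vertices P t = map (otail G) P ++ [ t ]

  Path⇒Linked : ∀ {s t} o P p → Path s (o ∷ P) t → t ≡ otail G p → Linked G (o ∷ P ++ [ p ])
  Path⇒Linked o []       p (_ , o→t)         t≡p = trans o→t t≡p , _
  Path⇒Linked o (o′ ∷ P) p (_ , o′≡ , path) t≡p = sym o′≡ , Path⇒Linked o′ P p (o′≡ , path) t≡p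

  closed-Path⇒Linked : ∀ a P → Path (ohead G a) P (otail G a) → Linked G (a ∷ P ++ [ a ])
  closed-Path⇒Linked a []      a→a           = a→a , _
  closed-Path⇒Linked a (p ∷ P) (p≡ , path) = sym p≡ , Path⇒Linked p P a (p≡ , path) refl

  positive-distinct-edges : ∀ {v} L → All (Pos v) L → Unique (map (otail G) L) → Unique (map proj₁ L)
  positive-distinct-edges {v} []      _              _               = []
  positive-distinct-edges {v} (o ∷ L) (pos-o ∷ pos-L) (o∉L ∷ unique) =
    distinct L pos-L o∉L ∷ positive-distinct-edges L pos-L unique
    where
    opposite-not-both-positive : ∀ e → Pos v (e , true) → Pos v (e , false) → ⊥
    opposite-not-both-positive e 0<ve 0<-ve =
      <-asym 0<ve (<-respˡ-≡ (neg-involutive (v e)) (neg-antimono-< 0<-ve))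
    distinct : ∀ L′ → All (Pos v) L′ → All (otail G o ≢_) (map (otail G) L′) → All (proj₁ o ≢_) (map proj₁ L′)
    distinct []        _               _               = []
    distinct (o′ ∷ L′) (pos-o′ ∷ pos-L′) (t≢t′ ∷ t≢L′) = same-edge o o′ pos-o pos-o′ t≢t′ ∷ distinct L′ pos-L′ t≢L′
      where
      same-edge : ∀ o o′ → Pos v o → Pos v o′ → otail G o ≢ otail G o′ → proj₁ o ≢ proj₁ o′
      same-edge (e , true)  (.e , true)  _ _ t≢t′ refl = t≢t′ refl
      same-edge (e , false) (.e , false) _ _ t≢t′ refl = t≢t′ refl
      same-edge (e , true)  (.e , false) p p′ _ refl = opposite-not-both-positive e p p′
      same-edge (e , false) (.e , true)  p p′ _ refl = opposite-not-both-positive e p′ p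

  cut-at : ∀ {v s t} P w → Path s P t → Unique (vertices P t) → All (Pos v) P → w ∈ vertices P t →
           ∃ λ pre → Path s pre w × All (Pos v) pre × Unique (w ∷ map (otail G) pre) ×
                     (∀ {u} → u ∈ map (otail G) pre → u ∈ vertices P t)
  cut-at []      w s≡t _ _ (here refl) = [] , s≡t , [] , [] ∷ [] , λ ()
  cut-at (p ∷ P) w (p≡s , _) _ _ (here refl) = [] , sym p≡s , [] , [] ∷ [] , λ ()
  cut-at (p ∷ P) w (p≡s , path) (p∉P ∷ unique) (pos-p ∷ pos-P) (there w∈P)
    with cut-at P w path unique pos-P w∈P
  ... | pre , path′ , pos-pre , (w∉pre ∷ unique-pre) , pre⊆P =
    p ∷ pre , (p≡s , path′) , pos-p ∷ pos-pre ,
    ((λ w≡p → All.lookup p∉P w∈P (sym w≡p)) ∷ w∉pre) ∷ (All.tabulate (λ u∈pre → All.lookup p∉P (pre⊆P u∈pre)) ∷ unique-pre) ,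
    λ { (here u≡p) → here u≡p ; (there u∈pre) → there (pre⊆P u∈pre) }

  -- Walk backwards along positive edges, keeping the visited vertices distinct, until an edge
  -- returns to the path; there are only n vertices, so this happens within n steps.
  close-circuit : ∀ {v} (fuel : ℕ) {s t} P a → IsFlow G v → Path s P t → Unique (vertices P t) → All (Pos v) P →
                  ohead G a ≡ s → Pos v a → n ℕ.≤ length (vertices P t) ℕ.+ fuel →
                  ∃ λ C → IsCircuit G C × All (Pos v) C
  close-circuit fuel {s} {t} P a fv path unique pos-P a→s pos-a enough
    with member? _≟ᶠ_ (otail G a) (vertices P t)
  ... | yes a∈P with cut-at P (otail G a) path unique pos-P a∈P
  ...   | pre , path′ , pos-pre , unique-pre , _ =
    a ∷ pre ,
    (closed-Path⇒Linked a pre (subst (λ w → Path w pre (otail G a)) (sym a→s) path′) , unique-pre ,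
     positive-distinct-edges (a ∷ pre) (pos-a ∷ pos-pre) unique-pre) ,
    pos-a ∷ pos-pre
  close-circuit zero {t = t} P a fv path unique pos-P a→s pos-a enough | no a∉P =
    ⊥-elim (ℕₚ.<-irrefl refl (ℕₚ.<-≤-trans (unique-length (¬Any⇒All¬ _ a∉P ∷ unique))
                                            (ℕₚ.≤-trans enough (ℕₚ.≤-reflexive (ℕₚ.+-identityʳ _)))))
  close-circuit (suc fuel) {t = t} P a fv path unique pos-P a→s pos-a enough | no a∉P
    with positive-in-edge fv a pos-a
  ... | a′ , a′→a , pos-a′ =
    close-circuit fuel (a ∷ P) a′ fv (refl , subst (λ w → Path w P t) (sym a→s) path)
      (¬Any⇒All¬ _ a∉P ∷ unique) (pos-a ∷ pos-P) a′→a pos-a′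
      (ℕₚ.≤-trans enough (ℕₚ.≤-reflexive (ℕₚ.+-suc (length (vertices P t)) fuel)))

  positive-circuit : ∀ {v} → IsFlow G v → ∀ o → Pos v o → ∃ λ C → IsCircuit G C × All (Pos v) C
  positive-circuit fv o pos-o = close-circuit n [] o fv refl ([] ∷ []) [] refl pos-o (ℕₚ.n≤1+n n)

  -- Conformal decomposition: an integral flow is a sum of circuits with no cancellation, so
  -- circuit inequalities imply the inequality for every integral flow.

  val-IsInteger : ∀ {v} → IsIntegral v → ∀ o → IsInteger (val G v o)
  val-IsInteger iv (e , true)  = iv e
  val-IsInteger iv (e , false) = IsInteger-neg (iv e)

  ∣∣-split-sgn : ∀ {x} f b → 1ℚ ≤ val G x (f , b) → ∣ x f ∣ ≡ ∣ x f - sgn b ∣ + ∣ sgn b ∣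
  ∣∣-split-sgn {x} f true  1≤x = 1≤p⇒∣p∣≡∣p-1∣+1 1≤x
  ∣∣-split-sgn {x} f false 1≤-x = begin
    ∣ x f ∣                  ≡⟨ sym (∣-p∣≡∣p∣ (x f)) ⟩
    ∣ - x f ∣                ≡⟨ 1≤p⇒∣p∣≡∣p-1∣+1 1≤-x ⟩
    ∣ - x f - 1ℚ ∣ + 1ℚ      ≡⟨ cong (λ t → ∣ t ∣ + 1ℚ) (negate (x f)) ⟩
    ∣ - (x f - - 1ℚ) ∣ + 1ℚ  ≡⟨ cong (_+ 1ℚ) (∣-p∣≡∣p∣ (x f - - 1ℚ)) ⟩
    ∣ x f - - 1ℚ ∣ + 1ℚ      ∎
    where
    open ≡-Reasoning
    negate : ∀ a → - a - 1ℚ ≡ - (a - - 1ℚ)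
    negate = solve-∀ ℚ-ring

  nonzero⇒positive-orientation : ∀ {v} e → v e ≢ 0ℚ → ∃ λ o → Pos v o
  nonzero⇒positive-orientation {v} e ve≢0 with <-cmp (v e) 0ℚ
  ... | tri< ve<0 _ _ = (e , false) , neg-antimono-< ve<0
  ... | tri≈ _ ve≡0 _ = ⊥-elim (ve≢0 ve≡0)
  ... | tri> _ _ 0<ve = (e , true) , 0<ve

  ∣sgn∣≡1 : ∀ b → ∣ sgn b ∣ ≡ 1ℚ
  ∣sgn∣≡1 true  = refl
  ∣sgn∣≡1 false = refl

  peel-circuit : ∀ {v} → IsFlow G v → IsIntegral v → ∀ e → v e ≢ 0ℚ →
                 ∃ λ c → Ξ₁ G c × (∀ f → ∣ v f ∣ ≡ ∣ v f - c f ∣ + ∣ c f ∣) × 1ℚ ≤ ∥ c ∥₁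
  peel-circuit {v} fv iv e ve≢0 with nonzero⇒positive-orientation e ve≢0
  ... | o , pos-o with positive-circuit fv o pos-o
  ... | C@((f₁ , _) ∷ _) , circuit@(_ , _ , distinct) , pos-C =
    xC G C , (C , circuit , λ _ → refl) , split , 1≤∥c∥
    where
    c = xC G C
    split : ∀ f → ∣ v f ∣ ≡ ∣ v f - c f ∣ + ∣ c f ∣
    split f with xC-entry C distinct f
    ... | inj₁ (_ , cf≡0) = subst (λ t → ∣ v f ∣ ≡ ∣ v f - t ∣ + ∣ t ∣) (sym cf≡0)
                              (sym (trans (+-identityʳ _) (cong ∣_∣ (+-identityʳ (v f)))))
    ... | inj₂ (b , fb∈C , cf≡sgn) = subst (λ t → ∣ v f ∣ ≡ ∣ v f - t ∣ + ∣ t ∣) (sym cf≡sgn)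
                              (∣∣-split-sgn f b (integer-pos⇒1≤ (val-IsInteger iv (f , b)) (All.lookup pos-C fb∈C)))
    1≤∣c[f₁]∣ : 1ℚ ≤ ∣ c f₁ ∣
    1≤∣c[f₁]∣ with xC-entry C distinct f₁
    ... | inj₁ (f₁≢f₁ ∷ _ , _) = ⊥-elim (f₁≢f₁ refl)
    ... | inj₂ (b , _ , cf≡sgn) = ≤-reflexive (sym (trans (cong ∣_∣ cf≡sgn) (∣sgn∣≡1 b)))
    1≤∥c∥ : 1ℚ ≤ ∥ c ∥₁
    1≤∥c∥ = ≤-trans 1≤∣c[f₁]∣ (term≤sum (λ f → 0≤∣p∣ (c f)) f₁)

  ∥∥₁-bound : ∀ {x} → CircuitBelow x → ∀ k {v} → IsFlow G v → IsIntegral v → ∥ v ∥₁ ≤ fromℤ (ℤ.+ k) →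
              two * (x · v) ≤ ∥ v ∥₁
  ∥∥₁-bound {x} below k {v} fv iv ∥v∥≤k with Finₚ.any? (λ e → ¬? (v e ≟ 0ℚ))
  ... | no v≗0 = ≤-reflexive (begin
    two * (x · v)   ≡⟨ cong (two *_) (trans (·-cong {x = x} {x′ = x} (λ _ → refl) v≗0ᵥ) (·-0ʳ x)) ⟩
    two * 0ℚ        ≡⟨ *-zeroʳ two ⟩
    0ℚ              ≡⟨ sym (sum-0 {m}) ⟩
    sum (λ (_ : Fin m) → 0ℚ) ≡⟨ sum-cong-≗ (λ e → cong ∣_∣ (sym (v≗0ᵥ e))) ⟩
    ∥ v ∥₁          ∎)
    where
    open ≡-Reasoning
    v≗0ᵥ : v ≗ 0ᵥ
    v≗0ᵥ e = decidable-stable (v e ≟ 0ℚ) (λ ve≢0 → v≗0 (e , ve≢0))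
  ... | yes (e , ve≢0) with peel-circuit fv iv e ve≢0
  ... | c , ξ , split , 1≤∥c∥ = peel k ∥v∥≤k
    where
    ∥v∥≡ : ∥ v ∥₁ ≡ ∥ v -ᵥ c ∥₁ + ∥ c ∥₁
    ∥v∥≡ = trans (sum-cong-≗ split) (∑-distrib-+ (λ f → ∣ v f - c f ∣) (λ f → ∣ c f ∣))
    1+∥v-c∥≤∥v∥ : ∥ v -ᵥ c ∥₁ + 1ℚ ≤ ∥ v ∥₁
    1+∥v-c∥≤∥v∥ = subst (∥ v -ᵥ c ∥₁ + 1ℚ ≤_) (sym ∥v∥≡) (+-monoʳ-≤ (∥ v -ᵥ c ∥₁) 1≤∥c∥)
    ∥c∥≤∥v∥ : ∥ c ∥₁ ≤ ∥ v ∥₁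
    ∥c∥≤∥v∥ = subst₂ _≤_ (+-identityˡ ∥ c ∥₁) (sym ∥v∥≡)
                (+-monoˡ-≤ ∥ c ∥₁ (sum-nonNeg (λ f → 0≤∣p∣ (v f - c f))))
    peel : ∀ k → ∥ v ∥₁ ≤ fromℤ (ℤ.+ k) → two * (x · v) ≤ ∥ v ∥₁
    peel zero ∥v∥≤0 = ⊥-elim (<-irrefl refl (<-≤-trans 0<1 (≤-trans (≤-trans 1≤∥c∥ ∥c∥≤∥v∥) ∥v∥≤0)))
    peel (suc k′) ∥v∥≤1+k′ = begin
      two * (x · v)                        ≡⟨ cong (two *_) (·-cong {x = x} {x′ = x} (λ _ → refl) v≗v-c+c) ⟩
      two * (x · (v -ᵥ c +ᵥ c))            ≡⟨ cong (two *_) (·-+ʳ x (v -ᵥ c) c) ⟩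
      two * (x · (v -ᵥ c) + x · c)         ≡⟨ *-distribˡ-+ two (x · (v -ᵥ c)) (x · c) ⟩
      two * (x · (v -ᵥ c)) + two * (x · c) ≤⟨ +-mono-≤ (∥∥₁-bound {x} below k′ fv-c iv-c ∥v-c∥≤k′) (subst (two * (x · c) ≤_) (Ξ₁-·-self ξ) (below c ξ)) ⟩
      ∥ v -ᵥ c ∥₁ + ∥ c ∥₁                  ≡⟨ sym ∥v∥≡ ⟩
      ∥ v ∥₁                                ∎
      where
      open ≤-Reasoning
      v≗v-c+c : v ≗ v -ᵥ c +ᵥ c
      v≗v-c+c f = split′ (v f) (c f)
        where
        split′ : ∀ a b → a ≡ a - b + b
        split′ = solve-∀ ℚ-ring
      fv-c : IsFlow G (v -ᵥ c)
      fv-c = IsFlow-- fv (Ξ₁-IsFlow ξ)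
      iv-c : IsIntegral (v -ᵥ c)
      iv-c f = IsInteger-+ (iv f) (IsInteger-neg (IsSign⇒IsInteger (Ξ₁-IsSign ξ f)))
      ∥v-c∥≤k′ : ∥ v -ᵥ c ∥₁ ≤ fromℤ (ℤ.+ k′)
      ∥v-c∥≤k′ = +-cancelʳ-≤ 1ℚ (≤-trans 1+∥v-c∥≤∥v∥
        (subst (∥ v ∥₁ ≤_) (trans (fromℤ-+ (ℤ.+ 1) (ℤ.+ k′)) (+-comm 1ℚ (fromℤ (ℤ.+ k′)))) ∥v∥≤1+k′))

  CircuitBelow⇒∥∥₁-bound : ∀ {x v} → CircuitBelow x → IsFlow G v → IsIntegral v → two * (x · v) ≤ ∥ v ∥₁
  CircuitBelow⇒∥∥₁-bound {x} below fv iv =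
    let k , ∥v∥≤k = integer-bounded (sum-integer (IsInteger-∣∣ ∘ iv)) in ∥∥₁-bound {x} below k fv iv ∥v∥≤k

  CircuitBelow⇒VO : ∀ {x} → IsFlow G x → CircuitBelow x → VO G x
  CircuitBelow⇒VO {x} fx below = Below⇒VO fx λ μ μ∈Λ →
    let iμ = IsIntFlow⇒IsIntegral μ∈Λ
    in ≤-trans (CircuitBelow⇒∥∥₁-bound {x} below (proj₁ μ∈Λ) iμ) (sum-mono-≤ (integer-∣∣≤square ∘ iμ))

  -- Circuit vectors are among the finitely many sign vectors, so one ε works for every circuit inequality
  -- that is slack at z; those tight at z are tight at x, hence along the whole line.
  VO-extends-beyond : ∀ {z x} → VO G z → VO G x → (∀ λ′ → Ξ₁ G λ′ → Hλ G λ′ z → Hλ G λ′ x) →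
                      ∃ λ ε → 0ℚ < ε × VO G (z +ᵥ ε *ᵥ (z -ᵥ x))
  VO-extends-beyond {z} {x} z∈VO x∈VO tight⇒tight =
    ε , 0<ε , CircuitBelow⇒VO (IsFlow-+ (proj₁ z∈VO) (IsFlow-* ε (IsFlow-- (proj₁ z∈VO) (proj₁ x∈VO)))) below
    where
    slack size : Vect G → ℚ
    slack s = s · s - two * (z · s)
    size  s = s · s - two * (x · s)
    choice : ∃ λ ε → 0ℚ < ε × (∀ {a} → a ∈ signVectors m → 0ℚ < slack a → ε * ∣ size a ∣ ≤ slack a)
    choice = uniformly-scale-below (signVectors m) slack size
    ε : ℚ
    ε = proj₁ choice
    0<ε : 0ℚ < ε
    0<ε = proj₁ (proj₂ choice)
    ε-ok : ∀ {a} → a ∈ signVectors m → 0ℚ < slack a → ε * ∣ size a ∣ ≤ slack a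
    ε-ok = proj₂ (proj₂ choice)
    below : CircuitBelow (z +ᵥ ε *ᵥ (z -ᵥ x))
    below λ′ ξ with signVectors-complete λ′ (Ξ₁-IsSign ξ)
    ... | s , s∈ , s≗λ′ = subst (_≤ Q) (sym expand) shifted≤Q
      where
      Z X Q : ℚ
      Z = two * (z · λ′)
      X = two * (x · λ′)
      Q = λ′ · λ′
      expand : two * ((z +ᵥ ε *ᵥ (z -ᵥ x)) · λ′) ≡ Z + ε * (Z - X)
      expand = begin
        two * ((z +ᵥ ε *ᵥ (z -ᵥ x)) · λ′)      ≡⟨ cong (two *_) (·-+ˡ z (ε *ᵥ (z -ᵥ x)) λ′) ⟩
        two * (z · λ′ + (ε *ᵥ (z -ᵥ x)) · λ′)  ≡⟨ cong (λ t → two * (z · λ′ + t)) (·-*ˡ ε (z -ᵥ x) λ′) ⟩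
        two * (z · λ′ + ε * ((z -ᵥ x) · λ′))   ≡⟨ cong (λ t → two * (z · λ′ + ε * t)) (·--ˡ z x λ′) ⟩
        two * (z · λ′ + ε * (z · λ′ - x · λ′)) ≡⟨ distribute (z · λ′) (x · λ′) ε ⟩
        Z + ε * (Z - X)                        ∎
        where
        open ≡-Reasoning
        distribute : ∀ a b ε → two * (a + ε * (a - b)) ≡ two * a + ε * (two * a - two * b)
        distribute = solve-∀ ℚ-ring
      s-as-λ′ : ∀ y → s · s - two * (y · s) ≡ Q - two * (y · λ′)
      s-as-λ′ y = cong₂ (λ a b → a - two * b) (·-cong s≗λ′ s≗λ′) (·-cong {x = y} {x′ = y} (λ _ → refl) s≗λ′)
      Z≤Q : Z ≤ Q
      Z≤Q = VO⇒CircuitBelow z∈VO λ′ ξ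
      shifted≤Q : Z + ε * (Z - X) ≤ Q
      shifted≤Q with Z <? Q
      ... | yes Z<Q = overshoot≤ (<⇒≤ 0<ε) Z≤Q
        (subst₂ (λ a b → ε * ∣ a ∣ ≤ b) (s-as-λ′ x) (s-as-λ′ z)
          (ε-ok s∈ (subst (0ℚ <_) (sym (s-as-λ′ z)) (p<q⇒0<q-p Z<Q))))
      ... | no Z≮Q = ≤-reflexive (begin
        Z + ε * (Z - X)   ≡⟨ cong₂ (λ a b → a + ε * (a - b)) Z≡Q X≡Q ⟩
        Q + ε * (Q - Q)   ≡⟨ cong (λ t → Q + ε * t) (+-inverseʳ Q) ⟩
        Q + ε * 0ℚ        ≡⟨ cong (Q +_) (*-zeroʳ ε) ⟩
        Q + 0ℚ            ≡⟨ +-identityʳ Q ⟩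
        Q                 ∎)
        where
        open ≡-Reasoning
        Z≡Q : Z ≡ Q
        Z≡Q = ≤-antisym Z≤Q (≮⇒≥ Z≮Q)
        X≡Q : X ≡ Q
        X≡Q = Hλ⇒≡ {λ′} {x} (tight⇒tight λ′ ξ (≡⇒Hλ {λ′} {z} Z≡Q))

  maximiser-extends : ∀ {c z x} → VO G z → (∀ y → VO G y → c · y ≤ c · z) → VO G x →
                      (∀ λ′ → Ξ₁ G λ′ → Hλ G λ′ z → Hλ G λ′ x) → c · z ≤ c · x
  maximiser-extends {c} {z} {x} z∈VO z-max x∈VO tight⇒tight =
    p+ε[p-q]≤p⇒p≤q {c · z} {c · x} {ε} 0<ε (subst (_≤ c · z) expand (z-max (z +ᵥ ε *ᵥ (z -ᵥ x)) (proj₂ (proj₂ beyond))))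
    where
    beyond : ∃ λ ε → 0ℚ < ε × VO G (z +ᵥ ε *ᵥ (z -ᵥ x))
    beyond = VO-extends-beyond z∈VO x∈VO tight⇒tight
    ε : ℚ
    ε = proj₁ beyond
    0<ε : 0ℚ < ε
    0<ε = proj₁ (proj₂ beyond)
    expand : c · (z +ᵥ ε *ᵥ (z -ᵥ x)) ≡ c · z + ε * (c · z - c · x)
    expand = begin
      c · (z +ᵥ ε *ᵥ (z -ᵥ x))      ≡⟨ ·-+ʳ c z (ε *ᵥ (z -ᵥ x)) ⟩
      c · z + c · (ε *ᵥ (z -ᵥ x))   ≡⟨ cong (c · z +_) (·-*ʳ ε c (z -ᵥ x)) ⟩
      c · z + ε * (c · (z -ᵥ x))    ≡⟨ cong (λ t → c · z + ε * t) (·--ʳ c z x) ⟩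
      c · z + ε * (c · z - c · x)   ∎
      where open ≡-Reasoning

  -- Faces of the Voronoi cell

  midpoint : Vect G → Vect G → Vect G
  midpoint z w = ½ *ᵥ (z +ᵥ w)

  ·-midpointˡ : ∀ z w y → midpoint z w · y ≡ ½ * (z · y + w · y)
  ·-midpointˡ z w y = trans (·-*ˡ ½ (z +ᵥ w) y) (cong (½ *_) (·-+ˡ z w y))

  ·-midpointʳ : ∀ c z w → c · midpoint z w ≡ ½ * (c · z + c · w)
  ·-midpointʳ c z w = trans (·-comm c _) (trans (·-midpointˡ z w c) (cong₂ (λ a b → ½ * (a + b)) (·-comm z c) (·-comm w c)))

  two*·-midpoint : ∀ z w y → two * (midpoint z w · y) ≡ ½ * (two * (z · y) + two * (w · y))
  two*·-midpoint z w y = trans (cong (two *_) (·-midpointˡ z w y)) (rearrange (z · y) (w · y))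
    where
    rearrange : ∀ a b → two * (½ * (a + b)) ≡ ½ * (two * a + two * b)
    rearrange = solve-∀ ℚ-ring

  VO-midpoint : ∀ {z w} → VO G z → VO G w → VO G (midpoint z w)
  VO-midpoint {z} {w} z∈VO w∈VO =
    Below⇒VO (IsFlow-* ½ (IsFlow-+ (proj₁ z∈VO) (proj₁ w∈VO))) λ μ μ∈Λ →
      subst (_≤ μ · μ) (sym (two*·-midpoint z w μ)) (½[p+q]≤r (VO⇒Below z∈VO μ∈Λ) (VO⇒Below w∈VO μ∈Λ))

  Hλ-midpoint : ∀ {z w λ′} → VO G z → VO G w → Ξ₁ G λ′ → Hλ G λ′ (midpoint z w) → Hλ G λ′ z × Hλ G λ′ w
  Hλ-midpoint {z} {w} {λ′} z∈VO w∈VO ξ tight =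
      ≡⇒Hλ {λ′} {z} (½[p+q]≡r⇒p≡r Z≤Q W≤Q on-bisector)
    , ≡⇒Hλ {λ′} {w} (½[p+q]≡r⇒p≡r W≤Q Z≤Q (trans (cong (½ *_) (+-comm W Z)) on-bisector))
    where
    Z W : ℚ
    Z = two * (z · λ′)
    W = two * (w · λ′)
    Z≤Q : Z ≤ λ′ · λ′
    Z≤Q = VO⇒CircuitBelow z∈VO λ′ ξ
    W≤Q : W ≤ λ′ · λ′
    W≤Q = VO⇒CircuitBelow w∈VO λ′ ξ
    on-bisector : ½ * (Z + W) ≡ λ′ · λ′
    on-bisector = trans (sym (two*·-midpoint z w λ′)) (Hλ⇒≡ {λ′} {midpoint z w} tight)

  module Face {F : Vect G → Set} (face : IsFace G F) where

    normal : Vect G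
    normal = proj₁ (proj₂ face)

    Maximal : Vect G → Set
    Maximal z = ∀ y → VO G y → normal · y ≤ normal · z

    F⇒VO : ∀ {z} → F z → VO G z
    F⇒VO {z} Fz = proj₁ (proj₁ (proj₂ (proj₂ face) z) Fz)

    F⇒Maximal : ∀ {z} → F z → Maximal z
    F⇒Maximal {z} Fz y y∈VO =
      subst₂ _≤_ (inner≡· normal y) (inner≡· normal z) (proj₂ (proj₁ (proj₂ (proj₂ face) z) Fz) y y∈VO)

    VO∧Maximal⇒F : ∀ {z} → VO G z → Maximal z → F z
    VO∧Maximal⇒F {z} z∈VO z-max = proj₂ (proj₂ (proj₂ face) z)
      (z∈VO , λ y y∈VO → subst₂ _≤_ (sym (inner≡· normal y)) (sym (inner≡· normal z)) (z-max y y∈VO))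

    F-midpoint : ∀ {z w} → F z → F w → F (midpoint z w)
    F-midpoint {z} {w} Fz Fw = VO∧Maximal⇒F (VO-midpoint (F⇒VO Fz) (F⇒VO Fw)) λ y y∈VO →
      subst (normal · y ≤_) (sym (·-midpointʳ normal z w)) (r≤½[p+q] (F⇒Maximal Fz y y∈VO) (F⇒Maximal Fw y y∈VO))

    TightOnFace : Vect G → Set
    TightOnFace λ′ = Ξ₁ G λ′ → ∀ w → F w → Hλ G λ′ w

    -- A point of F lying on no circuit hyperplane other than those containing all of F exists
    -- classically: average in one witness of non-tightness per sign vector.
    relative-interior-for : ∀ L → ¬ ¬ (∃ λ z → F z × ∀ {s} → s ∈ L → Hλ G s z → TightOnFace s)
    relative-interior-for []      = pure (proj₁ (proj₁ face) , proj₂ (proj₁ face) , λ ())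
      where open RawMonad ¬¬-Monad
    relative-interior-for (s ∷ L) = do
      (z , Fz , z-ok) ← relative-interior-for L
      witness? ← ¬¬-excluded-middle
      pure (add-s z Fz z-ok witness?)
      where
      open RawMonad ¬¬-Monad
      add-s : ∀ z → F z → (∀ {s′} → s′ ∈ L → Hλ G s′ z → TightOnFace s′) →
              Dec (∃ λ w → F w × Ξ₁ G s × ¬ Hλ G s w) →
              ∃ λ z′ → F z′ × ∀ {s′} → s′ ∈ s ∷ L → Hλ G s′ z′ → TightOnFace s′
      add-s z Fz z-ok (yes (w , Fw , ξ , ¬tight)) = midpoint z w , F-midpoint Fz Fw , λ
        { (here refl) tight _ → ⊥-elim (¬tight (proj₂ (Hλ-midpoint (F⇒VO Fz) (F⇒VO Fw) ξ tight)))
        ; (there s′∈L) tight ξ′ → z-ok s′∈L (proj₁ (Hλ-midpoint (F⇒VO Fz) (F⇒VO Fw) ξ′ tight)) ξ′ }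
      add-s z Fz z-ok (no none) = z , Fz , λ
        { (here refl) _ ξ w Fw → decidable-stable (_ ≟ _) (λ ¬tight → none (w , Fw , ξ , ¬tight))
        ; (there s′∈L) → z-ok s′∈L }

    relative-interior : ¬ ¬ (∃ λ z → F z × ∀ λ′ → Hλ G λ′ z → TightOnFace λ′)
    relative-interior = do
      (z , Fz , z-ok) ← relative-interior-for (signVectors m)
      pure (z , Fz , λ λ′ tight ξ w Fw →
        let s , s∈ , s≗λ′ = signVectors-complete λ′ (Ξ₁-IsSign ξ)
        in Hλ-resp {x = w} s≗λ′ (z-ok s∈ (Hλ-resp {x = z} (sym ∘ s≗λ′) tight) (Ξ₁-resp (sym ∘ s≗λ′) ξ) w Fw))
      where open RawMonad ¬¬-Monad

  -- Each edge e of λ′ lies on a circuit D e that is tight on F and agrees with λ′ at e.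
  -- The integral flow ν = Σₑ D e - λ′ then satisfies 2⟨x,ν⟩ ≤ ∥ν∥₁, and ∥ν∥₁ + ∥λ′∥₁ ≤ Σₑ ∥D e∥₁
  -- = 2⟨x, Σₑ D e⟩; subtracting gives ∥λ′∥₁ ≤ 2⟨x,λ′⟩.
  φ-support⇒Hλ : ∀ {F x λ′} → IsFace G F → F x → Ξ₁ G λ′ → (∀ o → supp G λ′ o → φ G F o) → Hλ G λ′ x
  φ-support⇒Hλ {F} {x} {λ′} face Fx ξ supp⊆φ = ≡⇒Hλ {λ′} {x} (≤-antisym (VO⇒CircuitBelow x∈VO λ′ ξ) Q≤2xλ′)
    where
    open Face face
    x∈VO : VO G x
    x∈VO = F⇒VO Fx
    TightPiece : Vect G → Set
    TightPiece D = IsFlow G D × (∀ f → IsSign (D f)) × two * (x · D) ≡ ∥ D ∥₁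
    circuit-piece : ∀ {C} → Ξ₁ G C → (∀ w → F w → Hλ G C w) → TightPiece C
    circuit-piece {C} ξC C-tight = Ξ₁-IsFlow ξC , Ξ₁-IsSign ξC , trans (Hλ⇒≡ {C} {x} (C-tight x Fx)) (Ξ₁-·-self ξC)
    zero-piece : TightPiece 0ᵥ
    zero-piece = IsFlow-0 , (λ _ → inj₁ refl) ,
      trans (cong (two *_) (·-0ʳ x)) (trans (*-zeroʳ two) (sym (sum-0 {m})))
    piece : ∀ e → ∃ λ D → TightPiece D × D e ≡ λ′ e
    piece e with Ξ₁-IsSign ξ e
    ... | inj₁ λ′e≡0 = 0ᵥ , zero-piece , sym λ′e≡0
    ... | inj₂ (inj₁ λ′e≡1) with supp⊆φ (e , true) (subst (0ℚ <_) (sym λ′e≡1) 0<1)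
    ...   | C , ξC , C-tight , pos =
      C , circuit-piece ξC C-tight , trans (IsSign-pos (Ξ₁-IsSign ξC e) pos) (sym λ′e≡1)
    piece e | inj₂ (inj₂ λ′e≡-1) with supp⊆φ (e , false) (subst (λ t → 0ℚ < - t) (sym λ′e≡-1) 0<1)
    ...   | C , ξC , C-tight , pos =
      C , circuit-piece ξC C-tight , trans (IsSign-neg (Ξ₁-IsSign ξC e) pos) (sym λ′e≡-1)
    D : Fin m → Vect G
    D e = proj₁ (piece e)
    D-tight : ∀ e → TightPiece (D e)
    D-tight e = proj₁ (proj₂ (piece e))
    D-diagonal : ∀ e → D e e ≡ λ′ e
    D-diagonal e = proj₂ (proj₂ (piece e))
    μ ν : Vect G
    μ f = sum (λ e → D e f)
    ν = μ -ᵥ λ′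
    2xμ≡ : two * (x · μ) ≡ sum (λ e → ∥ D e ∥₁)
    2xμ≡ = begin
      two * (x · μ)                   ≡⟨ cong (two *_) (trans (·-comm x μ) (·-sumˡ D x)) ⟩
      two * sum (λ e → D e · x)       ≡⟨ *-distribˡ-sum two (λ e → D e · x) ⟩
      sum (λ e → two * (D e · x))     ≡⟨ sum-cong-≗ (λ e → trans (cong (two *_) (·-comm (D e) x)) (proj₂ (proj₂ (D-tight e)))) ⟩
      sum (λ e → ∥ D e ∥₁)            ∎
      where open ≡-Reasoning
    ∥ν∥+∥λ′∥≤ : ∥ ν ∥₁ + ∥ λ′ ∥₁ ≤ sum (λ e → ∥ D e ∥₁)
    ∥ν∥+∥λ′∥≤ = begin
      ∥ ν ∥₁ + ∥ λ′ ∥₁                           ≡⟨ sym (∑-distrib-+ (λ f → ∣ ν f ∣) (λ f → ∣ λ′ f ∣)) ⟩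
      sum (λ f → ∣ ν f ∣ + ∣ λ′ f ∣)             ≤⟨ sum-mono-≤ pointwise ⟩
      sum (λ f → sum (λ e → ∣ D e f ∣))         ≡⟨ ∑-comm (λ f e → ∣ D e f ∣) ⟩
      sum (λ e → ∥ D e ∥₁)                      ∎
      where
      open ≤-Reasoning
      pointwise : ∀ f → ∣ ν f ∣ + ∣ λ′ f ∣ ≤ sum (λ e → ∣ D e f ∣)
      pointwise f = subst (λ t → ∣ μ f - t ∣ + ∣ t ∣ ≤ sum (λ e → ∣ D e f ∣)) (D-diagonal f)
                          (∣sum-term∣+∣term∣≤sum∣∣ (λ e → D e f) f)
    ν-flow : IsFlow G ν
    ν-flow = IsFlow-- (IsFlow-sum (proj₁ ∘ D-tight)) (Ξ₁-IsFlow ξ)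
    ν-integral : IsIntegral ν
    ν-integral f = IsInteger-+ (sum-integer (λ e → IsSign⇒IsInteger (proj₁ (proj₂ (D-tight e)) f)))
                               (IsInteger-neg (IsSign⇒IsInteger (Ξ₁-IsSign ξ f)))
    2xν≤∥ν∥ : two * (x · ν) ≤ ∥ ν ∥₁
    2xν≤∥ν∥ = CircuitBelow⇒∥∥₁-bound {x} (VO⇒CircuitBelow x∈VO) ν-flow ν-integral
    2xμ≡2xν+2xλ′ : two * (x · μ) ≡ two * (x · ν) + two * (x · λ′)
    2xμ≡2xν+2xλ′ = begin
      two * (x · μ)                         ≡⟨ cong (two *_) (·-cong {x = x} {x′ = x} (λ _ → refl) μ≗ν+λ′) ⟩
      two * (x · (ν +ᵥ λ′))                 ≡⟨ cong (two *_) (·-+ʳ x ν λ′) ⟩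
      two * (x · ν + x · λ′)                ≡⟨ *-distribˡ-+ two (x · ν) (x · λ′) ⟩
      two * (x · ν) + two * (x · λ′)        ∎
      where
      open ≡-Reasoning
      μ≗ν+λ′ : μ ≗ ν +ᵥ λ′
      μ≗ν+λ′ f = split (μ f) (λ′ f)
        where
        split : ∀ a b → a ≡ a - b + b
        split = solve-∀ ℚ-ring
    Q≤2xλ′ : λ′ · λ′ ≤ two * (x · λ′)
    Q≤2xλ′ = subst (_≤ two * (x · λ′)) (sym (Ξ₁-·-self ξ)) (+-cancelʳ-≤ (two * (x · ν)) (begin
      ∥ λ′ ∥₁ + two * (x · ν)            ≤⟨ +-monoʳ-≤ ∥ λ′ ∥₁ 2xν≤∥ν∥ ⟩
      ∥ λ′ ∥₁ + ∥ ν ∥₁                   ≡⟨ +-comm ∥ λ′ ∥₁ ∥ ν ∥₁ ⟩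
      ∥ ν ∥₁ + ∥ λ′ ∥₁                   ≤⟨ ∥ν∥+∥λ′∥≤ ⟩
      sum (λ e → ∥ D e ∥₁)               ≡⟨ sym 2xμ≡ ⟩
      two * (x · μ)                      ≡⟨ 2xμ≡2xν+2xλ′ ⟩
      two * (x · ν) + two * (x · λ′)     ≡⟨ +-comm (two * (x · ν)) (two * (x · λ′)) ⟩
      two * (x · λ′) + two * (x · ν)     ∎))
      where open ≤-Reasoning

  φ-antitone : ∀ {F₁ F₂ : Vect G → Set} → (∀ x → F₁ x → F₂ x) → ∀ o → φ G F₂ o → φ G F₁ o
  φ-antitone F₁⊆F₂ o (λ′ , ξ , F₂-tight , supp-o) = λ′ , ξ , (λ x F₁x → F₂-tight x (F₁⊆F₂ x F₁x)) , supp-o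

  φ-reflects-⊆ : ∀ {F₁ F₂} → IsFace G F₁ → IsFace G F₂ → (∀ o → φ G F₂ o → φ G F₁ o) → ∀ x → F₁ x → F₂ x
  φ-reflects-⊆ {F₁} {F₂} face₁ face₂ φ₂⊆φ₁ x F₁x = F₂.VO∧Maximal⇒F x∈VO x-maximal
    where
    module F₁ = Face face₁
    module F₂ = Face face₂
    x∈VO : VO G x
    x∈VO = F₁.F⇒VO F₁x
    x-maximal : F₂.Maximal x
    x-maximal y y∈VO = decidable-stable (F₂.normal · y ≤? F₂.normal · x) (¬¬-map via-interior F₂.relative-interior)
      where
      via-interior : (∃ λ z → F₂ z × ∀ λ′ → Hλ G λ′ z → F₂.TightOnFace λ′) → F₂.normal · y ≤ F₂.normal · x
      via-interior (z , F₂z , z-ok) = ≤-trans (F₂.F⇒Maximal F₂z y y∈VO)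
        (maximiser-extends {F₂.normal} {z} {x} (F₂.F⇒VO F₂z) (F₂.F⇒Maximal F₂z) x∈VO λ λ′ ξ tight →
          φ-support⇒Hλ face₁ F₁x ξ λ o supp-o → φ₂⊆φ₁ o (λ′ , ξ , z-ok λ′ tight ξ , supp-o))

lemma2p6 : (G : Graph) → Connected G →
    (F₁ F₂ : Vect G → Set) → IsFace G F₁ → IsFace G F₂ →
    ((∀ o → φ G F₁ o ⇔ φ G F₂ o) → ∀ x → F₁ x ⇔ F₂ x) ×
    ((∀ x → F₁ x → F₂ x) → ∀ o → φ G F₂ o → φ G F₁ o)
lemma2p6 G _ F₁ F₂ face₁ face₂ = injective , φ-antitone G
  where
  injective : (∀ o → φ G F₁ o ⇔ φ G F₂ o) → ∀ x → F₁ x ⇔ F₂ x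
  injective φ₁⇔φ₂ x = mk⇔ (φ-reflects-⊆ G face₁ face₂ (Equivalence.from ∘ φ₁⇔φ₂) x)
                          (φ-reflects-⊆ G face₂ face₁ (Equivalence.to ∘ φ₁⇔φ₂) x)
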